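{- A connected graph with exactly one triangle is competitively tight if and only if it has a cycle of length at least four.
   Context: All graphs are finite, simple and undirected. The competition graph $C(D)$ of a digraph $D$ is the graph with vertex set $V(D)$ in which distinct $x,y$ are adjacent iff there is a vertex $v$ with $(x,v),(y,v)$ both arcs of $D$. The competition number $k(G)$ is the minimum integer $k\ge 0$ such that $G$ together with $k$ new isolated vertices is the competition graph of an acyclic digraph. An edge clique cover of $G$ is a family of cliques such that each edge has both endpoints in some clique of the family; $\theta_E(G)$ is its minimum size. $G$ is competitively tight if $k(G)=\theta_E(G)-|V(G)|+2$. -}

module Defs where

open import Data.Nat using (ℕ; zero; suc; _+_; _≤_)
open import Data.Integer as ℤ using (ℤ; +_)
open import Data.Fin using (Fin; zero; suc; inject₁; fromℕ; splitAt; _<_)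
open import Data.Fin.Subset using (Subset; _∈_)
open import Data.Bool using (Bool; true; false; T)
open import Data.Sum using (_⊎_; inj₁; inj₂)
open import Data.Product using (Σ; ∃; ∃-syntax; _×_; _,_)
open import Relation.Nullary using (¬_)
open import Relation.Binary.PropositionalEquality using (_≡_; _≢_)
open import Relation.Binary.Construct.Closure.Transitive using (TransClosure)
open import Relation.Binary.Construct.Closure.ReflexiveTransitive using (Star)
open import Function.Bundles using (_⇔_)
open import Function.Definitions using (Injective)

record Graph : Set where
  field
    n     : ℕ
    adj   : Fin n → Fin n → Bool
    sym   : ∀ x y → adj x y ≡ adj y x
    irrefl : ∀ x → adj x x ≡ false

open Graph public

Adj : (G : Graph) → Fin (n G) → Fin (n G) → Set
Adj G x y = T (adj G x y)

Connected : Graph → Set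
Connected G = ∀ (x y : Fin (n G)) → Star (Adj G) x y

IsTriangle : (G : Graph) → Fin (n G) → Fin (n G) → Fin (n G) → Set
IsTriangle G a b c = a < b × b < c × Adj G a b × Adj G b c × Adj G a c

ExactlyOneTriangle : Graph → Set
ExactlyOneTriangle G =
  Σ (Fin (n G)) λ a → Σ (Fin (n G)) λ b → Σ (Fin (n G)) λ c →
    IsTriangle G a b c ×
    (∀ x y z → IsTriangle G x y z → (x ≡ a × y ≡ b × z ≡ c))

-- G contains a cycle (as a subgraph) of length at least four:
-- distinct vertices v 0, ..., v m with m ≥ 3 (length m+1 ≥ 4),
-- consecutive ones adjacent and v m adjacent to v 0.
HasCycleOfLengthAtLeast4 : Graph → Set
HasCycleOfLengthAtLeast4 G =
  Σ ℕ λ m → 3 ≤ m × Σ (Fin (suc m) → Fin (n G)) λ v →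
    Injective _≡_ _≡_ v ×
    (∀ (i : Fin m) → Adj G (v (inject₁ i)) (v (suc i))) ×
    Adj G (v (fromℕ m)) (v zero)

IsClique : (G : Graph) → Subset (n G) → Set
IsClique G C = ∀ x y → x ∈ C → y ∈ C → x ≢ y → Adj G x y

HasEdgeCliqueCover : (G : Graph) → ℕ → Set
HasEdgeCliqueCover G θ =
  Σ (Fin θ → Subset (n G)) λ C →
    (∀ i → IsClique G (C i)) ×
    (∀ x y → Adj G x y → ∃[ i ] (x ∈ C i × y ∈ C i))

IsEdgeCliqueCoverNumber : Graph → ℕ → Set
IsEdgeCliqueCoverNumber G θ =
  HasEdgeCliqueCover G θ × (∀ θ' → HasEdgeCliqueCover G θ' → θ ≤ θ')

Digraph : ℕ → Set
Digraph m = Fin m → Fin m → Bool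

Arc : ∀ {m} → Digraph m → Fin m → Fin m → Set
Arc D x y = T (D x y)

Acyclic : ∀ {m} → Digraph m → Set
Acyclic D = ∀ v → ¬ TransClosure (Arc D) v v

-- Adjacency of G together with k new isolated vertices, on Fin (n + k);
-- the first n vertices are those of G.
addIsolated : (G : Graph) (k : ℕ) → Fin (n G + k) → Fin (n G + k) → Bool
addIsolated G k x y with splitAt (n G) x | splitAt (n G) y
... | inj₁ a | inj₁ b = adj G a b
... | _      | _      = false

IsCompetitionGraphOf : ∀ {m} → (Fin m → Fin m → Bool) → Digraph m → Set
IsCompetitionGraphOf A D =
  ∀ x y → x ≢ y → (T (A x y) ⇔ (∃[ v ] (Arc D x v × Arc D y v)))

CompetitionRepresentable : Graph → ℕ → Set
CompetitionRepresentable G k =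
  Σ (Digraph (n G + k)) λ D → Acyclic D × IsCompetitionGraphOf (addIsolated G k) D

IsCompetitionNumber : Graph → ℕ → Set
IsCompetitionNumber G k =
  CompetitionRepresentable G k × (∀ k' → CompetitionRepresentable G k' → k ≤ k')

CompetitivelyTight : Graph → Set
CompetitivelyTight G =
  Σ ℕ λ k → Σ ℕ λ θ →
    IsCompetitionNumber G k × IsEdgeCliqueCoverNumber G θ ×
    (+ k ≡ ((+ θ) ℤ.- (+ n G)) ℤ.+ (+ 2))

-- Write n = |V(G)| and let N be the number of "codes": edges of G other than
-- ac and bc, the code ab standing for the clique T.  The proof combines:
--   * θ_E(G) = N, since a clique of G contains at most one code;
--   * Opsut's bound: if G ∪ I_k is the competition graph of an acyclic
--     digraph, then θ_E(G) ≤ n + k − 2, and k ≥ 1 as G has no isolated vertex;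
--     hence G is tight iff k(G) = N − (n − 2);
--   * without a cycle of length ≥ 4 every code but ab is a tree edge of a
--     spanning tree through a-b-c, so N ≤ n − 2 and G is not tight;
--   * with such a cycle, a spanning tree along it yields n − 2 distinct codes
--     whose cliques get n − 2 vertices of G as common prey; each of the
--     N − (n − 2) remaining codes gets a new isolated vertex as common prey,
--     which attains Opsut's bound.
module Submission where

open import Defs
open import Data.Nat using (ℕ; zero; suc; _+_; _∸_; _⊔_; _≤_; _<_; s≤s; z≤n; pred)
import Data.Nat.Properties as ℕP
open import Data.Fin using (Fin; zero; suc; toℕ; fromℕ; fromℕ<; inject₁; punchIn; punchOut; combine; remQuot; splitAt; join; _↑ˡ_; _↑ʳ_)
  renaming (_<_ to _<ᶠ_)
open import Data.Fin.Properties
  using ( _≟_; <-trans; <-cmp; <-irrefl; <-asym; any?; all?; ¬∀⟶∃¬; pigeonhole; injective⇒≤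
        ; toℕ<n; toℕ-injective; toℕ-fromℕ<; toℕ-inject₁; toℕ-fromℕ; suc-injective
        ; punchIn-punchOut; punchOut-injective; ↑ˡ-injective; splitAt-↑ˡ; splitAt-↑ʳ; join-splitAt
        ; remQuot-combine; combine-remQuot )
  renaming (_<?_ to _<ᶠ?_)
open import Data.Fin.Subset using (Subset; _∈_)
open import Data.Bool using (Bool; false; T)
open import Data.Bool.Properties using (T?; T-≡)
open import Data.Sum using (_⊎_; inj₁; inj₂)
open import Data.Product using (Σ; ∃; _×_; _,_; proj₁; proj₂; uncurry)
open import Data.Empty using (⊥; ⊥-elim)
open import Data.Vec using (tabulate)
open import Data.Vec.Properties using (lookup∘tabulate; []=⇒lookup; lookup⇒[]=)
open import Relation.Nullary using (¬_; Dec; yes; no)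
open import Relation.Nullary.Decidable using (⌊_⌋; toWitness; fromWitness; _×-dec_; _⊎-dec_; _→-dec_; ¬?; decidable-stable)
open import Relation.Binary using (tri<; tri≈; tri>)
open import Relation.Binary.PropositionalEquality using (_≡_; _≢_; refl; trans; cong; cong₂; subst; subst₂; module ≡-Reasoning) renaming (sym to ≡-sym)
open import Relation.Binary.Construct.Closure.ReflexiveTransitive using (Star; ε; _◅_; _◅◅_) renaming (reverse to reverseStar)
open import Relation.Binary.Construct.Closure.Transitive using (TransClosure; [_]; _∷_; _∷ʳ_)
open import Function.Bundles using (_⇔_; mk⇔; Equivalence)
open import Data.Integer as ℤ using (ℤ; +_)
import Data.Integer.Properties as ℤP
open import Data.Integer.Tactic.RingSolver using (solve-∀)

module GraphFacts (G : Graph) where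

  adjSym : ∀ {x y} → Adj G x y → Adj G y x
  adjSym {x} {y} = subst T (Graph.sym G x y)

  adj≢ : ∀ {x y} → Adj G x y → x ≢ y
  adj≢ {x} p refl = subst T (Graph.irrefl G x) p

record Enumeration {m : ℕ} (P : Fin m → Set) : Set where
  field
    size      : ℕ
    elem      : Fin size → Fin m
    elem-sat  : ∀ i → P (elem i)
    elem-inj  : ∀ i j → elem i ≡ elem j → i ≡ j
    elem-onto : ∀ x → P x → ∃ λ i → elem i ≡ x

enumerate : ∀ {m} (P : Fin m → Set) → (∀ x → Dec (P x)) → Enumeration P
enumerate {zero} P P? = record
  { size = 0 ; elem = λ () ; elem-sat = λ () ; elem-inj = λ () ; elem-onto = λ () }
enumerate {suc m} P P? with enumerate (λ x → P (suc x)) (λ x → P? (suc x)) | P? zero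
... | E | yes p0 = record
  { size = suc size ; elem = e ; elem-sat = e-sat ; elem-inj = e-inj ; elem-onto = e-onto }
  where
  open Enumeration E
  e : Fin (suc size) → Fin (suc m)
  e zero    = zero
  e (suc i) = suc (elem i)
  e-sat : ∀ i → P (e i)
  e-sat zero    = p0
  e-sat (suc i) = elem-sat i
  e-inj : ∀ i j → e i ≡ e j → i ≡ j
  e-inj zero    zero    _ = refl
  e-inj (suc i) (suc j) q = cong suc (elem-inj i j (suc-injective q))
  e-onto : ∀ x → P x → ∃ λ i → e i ≡ x
  e-onto zero    _  = zero , refl
  e-onto (suc x) px with elem-onto x px
  ... | i , q = suc i , cong suc q
... | E | no ¬p0 = record
  { size = size ; elem = λ i → suc (elem i) ; elem-sat = elem-sat
  ; elem-inj = λ i j q → elem-inj i j (suc-injective q) ; elem-onto = e-onto }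
  where
  open Enumeration E
  e-onto : ∀ x → P x → ∃ λ i → suc (elem i) ≡ x
  e-onto zero    p0 = ⊥-elim (¬p0 p0)
  e-onto (suc x) px with elem-onto x px
  ... | i , q = i , cong suc q

record PairEnumeration {m : ℕ} (R : Fin m → Fin m → Set) : Set where
  field
    size      : ℕ
    elem      : Fin size → Fin m × Fin m
    elem-sat  : ∀ i → uncurry R (elem i)
    elem-inj  : ∀ i j → elem i ≡ elem j → i ≡ j
    elem-onto : ∀ x y → R x y → ∃ λ i → elem i ≡ (x , y)

enumeratePairs : ∀ {m} (R : Fin m → Fin m → Set) → (∀ x y → Dec (R x y)) → PairEnumeration R
enumeratePairs {m} R R? = record
  { size = size ; elem = λ i → pair (elem i) ; elem-sat = elem-sat
  ; elem-inj = λ i j q → elem-inj i j (trans (≡-sym (combine-remQuot {m} m (elem i)))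
                                        (trans (cong (uncurry combine) q) (combine-remQuot {m} m (elem j))))
  ; elem-onto = onto }
  where
  pair : Fin (m Data.Nat.* m) → Fin m × Fin m
  pair = remQuot {m} m
  E : Enumeration (λ i → uncurry R (pair i))
  E = enumerate (λ i → uncurry R (pair i)) (λ i → R? (proj₁ (pair i)) (proj₂ (pair i)))
  open Enumeration E
  onto : ∀ x y → R x y → ∃ λ i → pair (elem i) ≡ (x , y)
  onto x y r with elem-onto (combine x y) (subst (uncurry R) (≡-sym (remQuot-combine x y)) r)
  ... | i , q = i , trans (cong pair q) (remQuot-combine x y)

subsetOf : ∀ {m} {P : Fin m → Set} → (∀ x → Dec (P x)) → Subset m
subsetOf P? = tabulate (λ x → ⌊ P? x ⌋)

∈-subsetOf⁻ : ∀ {m} {P : Fin m → Set} (P? : ∀ x → Dec (P x)) {x} → x ∈ subsetOf P? → P x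
∈-subsetOf⁻ P? {x} x∈ =
  toWitness (Equivalence.from T-≡ (trans (≡-sym (lookup∘tabulate (λ y → ⌊ P? y ⌋) x)) ([]=⇒lookup x∈)))

∈-subsetOf⁺ : ∀ {m} {P : Fin m → Set} (P? : ∀ x → Dec (P x)) {x} → P x → x ∈ subsetOf P?
∈-subsetOf⁺ P? {x} px =
  lookup⇒[]= x (subsetOf P?) (trans (lookup∘tabulate (λ y → ⌊ P? y ⌋) x) (Equivalence.to T-≡ (fromWitness px)))

injective⇒surjective : ∀ {m} (f : Fin m → Fin m) → (∀ i j → f i ≡ f j → i ≡ j) → ∀ v → ∃ λ i → f i ≡ v
injective⇒surjective {zero}  f inj ()
injective⇒surjective {suc m} f inj v with any? (λ i → f i ≟ v)
... | yes hit = hit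
... | no miss = ⊥-elim (ℕP.<-irrefl refl (injective⇒≤ {f = g} g-inj))
  where
  g : Fin (suc m) → Fin m
  g i = punchOut {i = v} (λ e → miss (i , ≡-sym e))
  g-inj : ∀ {i j} → g i ≡ g j → i ≡ j
  g-inj {i} {j} e = inj i j (punchOut-injective (λ e → miss (i , ≡-sym e)) (λ e → miss (j , ≡-sym e)) e)

boundedInjection⇒≤ : ∀ {N B} (g : Fin N → ℕ) → (∀ i → g i < B) → (∀ i j → g i ≡ g j → i ≡ j) → N ≤ B
boundedInjection⇒≤ g g< g-inj = injective⇒≤ {f = λ i → fromℕ< (g< i)}
  (λ {i} {j} e → g-inj i j (trans (≡-sym (toℕ-fromℕ< (g< i))) (trans (cong toℕ e) (toℕ-fromℕ< (g< j)))))

record SimplePath {m} (R : Fin m → Fin m → Set) (u v : Fin m) : Set where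
  field
    L    : ℕ
    f    : ℕ → Fin m
    f0   : f 0 ≡ u
    fL   : f L ≡ v
    inj  : ∀ i j → i ≤ L → j ≤ L → f i ≡ f j → i ≡ j
    step : ∀ i → i < L → R (f i) (f (suc i))

-- Every walk contains a simple path with the same ends: shorten the walk
-- from its second vertex recursively, then either prepend u or, if u
-- already occurs on that path, cut the path at that occurrence.
simplePath : ∀ {m} {R : Fin m → Fin m → Set} {u v} → Star R u v → SimplePath R u v
simplePath {u = u} ε = record
  { L = 0 ; f = λ _ → u ; f0 = refl ; fL = refl
  ; inj = λ { zero zero _ _ _ → refl } ; step = λ _ () }
simplePath {m} {R} {u} (r ◅ walk) with simplePath walk
... | P with any? {P = λ (j : Fin (suc (SimplePath.L P))) → SimplePath.f P (toℕ j) ≡ u}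
               (λ j → SimplePath.f P (toℕ j) ≟ u)
... | yes (j , fj≡u) = record
  { L = L ∸ toℕ j ; f = λ i → f (i + toℕ j) ; f0 = fj≡u
  ; fL = trans (cong f (ℕP.m∸n+n≡m j≤L)) fL
  ; inj = λ i k i≤ k≤ q → ℕP.+-cancelʳ-≡ (toℕ j) i k (inj _ _ (shift i≤) (shift k≤) q)
  ; step = λ i i< → step (i + toℕ j) (subst (i + toℕ j <_) (ℕP.m∸n+n≡m j≤L) (ℕP.+-monoˡ-< (toℕ j) i<)) }
  where
  open SimplePath P
  j≤L : toℕ j ≤ L
  j≤L = ℕP.≤-pred (toℕ<n j)
  shift : ∀ {i} → i ≤ L ∸ toℕ j → i + toℕ j ≤ L
  shift {i} le = subst (i + toℕ j ≤_) (ℕP.m∸n+n≡m j≤L) (ℕP.+-monoˡ-≤ (toℕ j) le)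
... | no u∉P = record { L = suc L ; f = f' ; f0 = refl ; fL = fL ; inj = inj' ; step = step' }
  where
  open SimplePath P
  f' : ℕ → Fin m
  f' zero    = u
  f' (suc i) = f i
  fresh : ∀ i → i ≤ L → f i ≢ u
  fresh i le e = u∉P (fromℕ< (s≤s le) , trans (cong f (toℕ-fromℕ< (s≤s le))) e)
  inj' : ∀ i j → i ≤ suc L → j ≤ suc L → f' i ≡ f' j → i ≡ j
  inj' zero    zero    _  _  _ = refl
  inj' zero    (suc j) _  lj e = ⊥-elim (fresh j (ℕP.≤-pred lj) (≡-sym e))
  inj' (suc i) zero    li _  e = ⊥-elim (fresh i (ℕP.≤-pred li) e)
  inj' (suc i) (suc j) li lj e = cong suc (inj i j (ℕP.≤-pred li) (ℕP.≤-pred lj) e)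
  step' : ∀ i → i < suc L → R (f' i) (f' (suc i))
  step' zero    _  = subst (R u) (≡-sym f0) r
  step' (suc i) lt = step i (ℕP.≤-pred lt)

-- If every vertex of a digraph on a nonempty finite set has an in-arc,
-- walking backwards along in-arcs for |V| steps repeats a vertex
-- (pigeonhole) and so closes a directed cycle.
module BackwardsWalk {M} (D : Digraph (suc M)) (entered : ∀ s → ∃ λ u → Arc D u s) where

  back : ℕ → Fin (suc M)
  back zero    = zero
  back (suc i) = proj₁ (entered (back i))

  backPath : ∀ i d → TransClosure (Arc D) (back (suc d + i)) (back i)
  backPath i zero    = [ proj₂ (entered (back i)) ]
  backPath i (suc d) = proj₂ (entered (back (suc d + i))) ∷ backPath i d

  cycle : ∃ λ v → TransClosure (Arc D) v v
  cycle with pigeonhole (ℕP.n<1+n (suc M)) (λ (t : Fin (suc (suc M))) → back (toℕ t))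
  ... | i , j , i<j , same = back (toℕ j) ,
        subst (λ t → TransClosure (Arc D) (back t) (back (toℕ j))) j≡
          (subst (TransClosure (Arc D) (back (suc d + toℕ i))) same (backPath (toℕ i) d))
    where
    d : ℕ
    d = toℕ j ∸ suc (toℕ i)
    j≡ : suc d + toℕ i ≡ toℕ j
    j≡ = trans (≡-sym (ℕP.+-suc d (toℕ i))) (ℕP.m∸n+n≡m i<j)

-- Hence an acyclic digraph on a nonempty vertex set has a source.
-- (Abstract: only the existence of a source is used, never its value.)
abstract
  acyclic⇒source : ∀ {M} (D : Digraph (suc M)) → Acyclic D → ∃ λ s → ∀ u → ¬ Arc D u s
  acyclic⇒source {M} D acyclic with any? (λ s → all? (λ u → ¬? (T? (D u s))))
  ... | yes source = source
  ... | no ¬source = ⊥-elim (acyclic _ (proj₂ (BackwardsWalk.cycle D entered)))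
    where
    entered : ∀ s → ∃ λ u → Arc D u s
    entered s with ¬∀⟶∃¬ (suc M) (λ u → ¬ Arc D u s) (λ u → ¬? (T? (D u s))) (λ h → ¬source (s , h))
    ... | u , ¬¬arc = u , decidable-stable (T? (D u s)) ¬¬arc

-- Dually, a nonempty acyclic digraph has a vertex without out-arcs.
acyclic⇒sink : ∀ {M} (D : Digraph M) → Acyclic D → Fin M → ∃ λ t → ∀ u → ¬ Arc D t u
acyclic⇒sink {suc M} D acyclic _ = acyclic⇒source (λ u v → D v u) (λ v p → acyclic v (reverse p))
  where
  reverse : ∀ {u v} → TransClosure (λ x y → Arc D y x) u v → TransClosure (Arc D) v u
  reverse [ r ]    = [ r ]
  reverse (r ∷ p) = reverse p ∷ʳ r

deleteVertex : ∀ {M} → Digraph (suc M) → Fin (suc M) → Digraph M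
deleteVertex D s x y = D (punchIn s x) (punchIn s y)

deleteVertex-acyclic : ∀ {M} (D : Digraph (suc M)) s → Acyclic D → Acyclic (deleteVertex D s)
deleteVertex-acyclic D s acyclic v p = acyclic (punchIn s v) (lift p)
  where
  lift : ∀ {x y} → TransClosure (Arc (deleteVertex D s)) x y → TransClosure (Arc D) (punchIn s x) (punchIn s y)
  lift [ r ]    = [ r ]
  lift (r ∷ p) = r ∷ lift p

-- In an acyclic digraph on M + 2 vertices, all vertices having in-arcs from
-- two distinct vertices lie among some M vertices: they avoid a source s
-- and a source of D − s.
twoSources : ∀ {V M} → V ≡ suc (suc M) → (D : Digraph V) → Acyclic D →
  Σ (Fin M → Fin V) λ w →
    ∀ v x y → x ≢ y → Arc D x v → Arc D y v → ∃ λ j → w j ≡ v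
twoSources {M = M} refl D acyclic = w , covered
  where
  s : Fin (suc (suc M))
  s = proj₁ (acyclic⇒source D acyclic)
  D' : Digraph (suc M)
  D' = deleteVertex D s
  s' : Fin (suc M)
  s' = proj₁ (acyclic⇒source D' (deleteVertex-acyclic D s acyclic))
  w = λ j → punchIn s (punchIn s' j)
  s'-source : ∀ z → z ≢ s → ¬ Arc D z (punchIn s s')
  s'-source z z≢s arc = proj₂ (acyclic⇒source D' (deleteVertex-acyclic D s acyclic)) (punchOut z≢s')
    (subst (λ t → Arc D t (punchIn s s')) (≡-sym (punchIn-punchOut z≢s')) arc)
    where
    z≢s' : s ≢ z
    z≢s' e = z≢s (≡-sym e)
  covered : ∀ v x y → x ≢ y → Arc D x v → Arc D y v → ∃ λ j → w j ≡ v
  covered v x y x≢y x→v y→v with v ≟ s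
  ... | yes refl = ⊥-elim (proj₂ (acyclic⇒source D acyclic) x x→v)
  ... | no v≢s = punchOut v'≢s' , trans (cong (punchIn s) (punchIn-punchOut v'≢s')) v≡
    where
    s≢v : s ≢ v
    s≢v e = v≢s (≡-sym e)
    v≡ : punchIn s (punchOut s≢v) ≡ v
    v≡ = punchIn-punchOut s≢v
    v'≢s' : s' ≢ punchOut s≢v
    v'≢s' e with x ≟ s
    ... | no x≢s  = s'-source x x≢s (subst (Arc D x) (trans (≡-sym v≡) (cong (punchIn s) (≡-sym e))) x→v)
    ... | yes refl = s'-source y (λ y≡s → x≢y (≡-sym y≡s))
                       (subst (Arc D y) (trans (≡-sym v≡) (cong (punchIn s) (≡-sym e))) y→v)

addIsolated-↑ˡ : ∀ G k x y → addIsolated G k (x ↑ˡ k) (y ↑ˡ k) ≡ adj G x y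
addIsolated-↑ˡ G k x y rewrite splitAt-↑ˡ (n G) x k | splitAt-↑ˡ (n G) y k = refl

adjOrNone : (G : Graph) {k : ℕ} → Fin (n G) ⊎ Fin k → Fin (n G) ⊎ Fin k → Bool
adjOrNone G (inj₁ x) (inj₁ y) = adj G x y
adjOrNone G _        _        = false

addIsolated-split : ∀ G k u w → addIsolated G k u w ≡ adjOrNone G (splitAt (n G) u) (splitAt (n G) w)
addIsolated-split G k u w with splitAt (n G) u | splitAt (n G) w
... | inj₁ _ | inj₁ _ = refl
... | inj₁ _ | inj₂ _ = refl
... | inj₂ _ | inj₁ _ = refl
... | inj₂ _ | inj₂ _ = refl

module Representation (G : Graph) (k : ℕ) (D : Digraph (n G + k))
    (rep : IsCompetitionGraphOf (addIsolated G k) D) where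
  open GraphFacts G

  adj⇒commonPrey : ∀ {x y} → Adj G x y → ∃ λ v → Arc D (x ↑ˡ k) v × Arc D (y ↑ˡ k) v
  adj⇒commonPrey {x} {y} xy =
    Equivalence.to (rep (x ↑ˡ k) (y ↑ˡ k) (λ e → adj≢ xy (↑ˡ-injective k x y e)))
      (subst T (≡-sym (addIsolated-↑ˡ G k x y)) xy)

  commonPrey⇒adj : ∀ {x y v} → x ≢ y → Arc D (x ↑ˡ k) v → Arc D (y ↑ˡ k) v → Adj G x y
  commonPrey⇒adj {x} {y} {v} x≢y x→v y→v = subst T (addIsolated-↑ˡ G k x y)
    (Equivalence.from (rep (x ↑ˡ k) (y ↑ˡ k) (λ e → x≢y (↑ˡ-injective k x y e))) (v , x→v , y→v))

-- Opsut's bound: if G ∪ I_k = C(D) with D acyclic and |V(G)| + k = M + 2,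
-- the in-neighbourhoods in D of the M vertices avoiding two sources, cut
-- down to V(G), form an edge clique cover of G.
opsutBound : ∀ G k M → CompetitionRepresentable G k → n G + k ≡ suc (suc M) → HasEdgeCliqueCover G M
opsutBound G k M (D , acyclic , rep) size with twoSources size D acyclic
... | w , hit = C , isClique , covers
  where
  open Representation G k D rep
  open GraphFacts G
  C : Fin M → Subset (n G)
  C j = subsetOf (λ x → T? (D (x ↑ˡ k) (w j)))
  isClique : ∀ j → IsClique G (C j)
  isClique j x y x∈ y∈ x≢y = commonPrey⇒adj x≢y (∈-subsetOf⁻ _ x∈) (∈-subsetOf⁻ _ y∈)
  covers : ∀ x y → Adj G x y → ∃ λ j → x ∈ C j × y ∈ C j
  covers x y xy with adj⇒commonPrey xy
  ... | v , x→v , y→v with hit v _ _ (λ e → adj≢ xy (↑ˡ-injective k x y e)) x→v y→v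
  ... | j , refl = j , ∈-subsetOf⁺ _ x→v , ∈-subsetOf⁺ _ y→v

-- A graph with at least one vertex and no isolated vertex has positive
-- competition number: a sink of D would be a vertex of G without prey,
-- hence isolated.
noIsolated⇒¬representable₀ : ∀ G → Fin (n G) → (∀ x → ∃ λ y → Adj G x y) → ¬ CompetitionRepresentable G 0
noIsolated⇒¬representable₀ G x₀ neighbour (D , acyclic , rep) with acyclic⇒sink D acyclic (x₀ ↑ˡ 0)
... | t , t-sink = noPrey (splitAt (n G) t) refl
  where
  open Representation G 0 D rep
  noPrey : ∀ r → splitAt (n G) t ≡ r → ⊥
  noPrey (inj₁ x) split with adj⇒commonPrey (proj₂ (neighbour x))
  ... | v , x→v , _ = t-sink v (subst (λ u → Arc D u v) (≡-sym t≡x) x→v)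
    where
    t≡x : t ≡ x ↑ˡ 0
    t≡x = trans (≡-sym (join-splitAt (n G) 0 t)) (cong (join (n G) 0) split)

module UniqueTriangle (G : Graph) (a b c : Fin (n G)) (tri : IsTriangle G a b c)
    (uniq : ∀ x y z → IsTriangle G x y z → (x ≡ a × y ≡ b × z ≡ c)) where

  open GraphFacts G public

  V : Set
  V = Fin (n G)

  a<b : a <ᶠ b
  a<b = proj₁ tri
  b<c : b <ᶠ c
  b<c = proj₁ (proj₂ tri)
  a<c : a <ᶠ c
  a<c = <-trans a<b b<c
  Aab : Adj G a b
  Aab = proj₁ (proj₂ (proj₂ tri))
  Abc : Adj G b c
  Abc = proj₁ (proj₂ (proj₂ (proj₂ tri)))
  Aac : Adj G a c
  Aac = proj₂ (proj₂ (proj₂ (proj₂ tri)))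

  inT : V → Set
  inT x = x ≡ a ⊎ (x ≡ b ⊎ x ≡ c)

  inT? : ∀ x → Dec (inT x)
  inT? x = (x ≟ a) ⊎-dec ((x ≟ b) ⊎-dec (x ≟ c))

  aT : inT a
  aT = inj₁ refl
  bT : inT b
  bT = inj₂ (inj₁ refl)
  cT : inT c
  cT = inj₂ (inj₂ refl)

  tag : ∀ {x} → inT x → Fin 3
  tag (inj₁ _)        = zero
  tag (inj₂ (inj₁ _)) = suc zero
  tag (inj₂ (inj₂ _)) = suc (suc zero)

  tag-inj : ∀ {x y} (p : inT x) (q : inT y) → tag p ≡ tag q → x ≡ y
  tag-inj (inj₁ refl)        (inj₁ refl)        _ = refl
  tag-inj (inj₂ (inj₁ refl)) (inj₂ (inj₁ refl)) _ = refl
  tag-inj (inj₂ (inj₂ refl)) (inj₂ (inj₂ refl)) _ = refl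
  tag-inj (inj₁ _)        (inj₂ (inj₁ _)) ()
  tag-inj (inj₁ _)        (inj₂ (inj₂ _)) ()
  tag-inj (inj₂ (inj₁ _)) (inj₁ _)        ()
  tag-inj (inj₂ (inj₁ _)) (inj₂ (inj₂ _)) ()
  tag-inj (inj₂ (inj₂ _)) (inj₁ _)        ()
  tag-inj (inj₂ (inj₂ _)) (inj₂ (inj₁ _)) ()

  sortedTriangle⇒inT : ∀ {x y z} → x <ᶠ y → y <ᶠ z → Adj G x y → Adj G y z → Adj G x z →
    inT x × inT y × inT z
  sortedTriangle⇒inT p q r s t with uniq _ _ _ (p , q , r , s , t)
  ... | refl , refl , refl = aT , bT , cT

  triangle⇒inT : ∀ {x y z} → Adj G x y → Adj G y z → Adj G x z → inT x × inT y × inT z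
  triangle⇒inT {x} {y} {z} xy yz xz with <-cmp x y | <-cmp y z | <-cmp x z
  ... | tri≈ _ e _ | _ | _ = ⊥-elim (adj≢ xy e)
  ... | _ | tri≈ _ e _ | _ = ⊥-elim (adj≢ yz e)
  ... | _ | _ | tri≈ _ e _ = ⊥-elim (adj≢ xz e)
  ... | tri< p _ _ | tri< q _ _ | _ = sortedTriangle⇒inT p q xy yz xz
  ... | tri< p _ _ | tri> _ _ q | tri< r _ _ with sortedTriangle⇒inT r q xz (adjSym yz) xy
  ...   | u , v , w = u , w , v
  triangle⇒inT xy yz xz | tri< p _ _ | tri> _ _ q | tri> _ _ r with sortedTriangle⇒inT r p (adjSym xz) xy (adjSym yz)
  ...   | u , v , w = v , w , u
  triangle⇒inT xy yz xz | tri> _ _ p | tri< q _ _ | tri< r _ _ with sortedTriangle⇒inT p r (adjSym xy) xz yz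
  ...   | u , v , w = v , u , w
  triangle⇒inT xy yz xz | tri> _ _ p | tri< q _ _ | tri> _ _ r with sortedTriangle⇒inT q r yz (adjSym xz) (adjSym xy)
  ...   | u , v , w = w , u , v
  triangle⇒inT xy yz xz | tri> _ _ p | tri> _ _ q | _ with sortedTriangle⇒inT q p (adjSym yz) (adjSym xy) (adjSym xz)
  ...   | u , v , w = w , v , u

  noFourInT : ∀ {x y z w} → inT x → inT y → inT z → inT w →
    x ≢ y → x ≢ z → x ≢ w → y ≢ z → y ≢ w → z ≢ w → ⊥
  noFourInT px py pz pw x≢y x≢z x≢w y≢z y≢w z≢w with pigeonhole (ℕP.n<1+n 3) tagOf
    where
    tagOf : Fin 4 → Fin 3
    tagOf zero                   = tag px
    tagOf (suc zero)             = tag py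
    tagOf (suc (suc zero))       = tag pz
    tagOf (suc (suc (suc zero))) = tag pw
  ... | zero , suc zero , _ , e                         = x≢y (tag-inj px py e)
  ... | zero , suc (suc zero) , _ , e                   = x≢z (tag-inj px pz e)
  ... | zero , suc (suc (suc zero)) , _ , e             = x≢w (tag-inj px pw e)
  ... | suc zero , suc (suc zero) , _ , e               = y≢z (tag-inj py pz e)
  ... | suc zero , suc (suc (suc zero)) , _ , e         = y≢w (tag-inj py pw e)
  ... | suc (suc zero) , suc (suc (suc zero)) , _ , e   = z≢w (tag-inj pz pw e)
  ... | suc zero , suc zero , s≤s () , _
  ... | suc (suc _) , suc zero , s≤s () , _
  ... | suc (suc _) , suc (suc zero) , s≤s (s≤s ()) , _
  ... | suc (suc (suc _)) , suc (suc (suc zero)) , s≤s (s≤s (s≤s ())) , _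

  -- The code ab stands
  -- for the clique T, every other code xy for the clique {x, y}; together
  -- these are exactly the maximal cliques with at least one edge.
  Code : V → V → Set
  Code x y = x <ᶠ y × Adj G x y × ¬ (x ≡ a × y ≡ c) × ¬ (x ≡ b × y ≡ c)

  code? : ∀ x y → Dec (Code x y)
  code? x y = (x <ᶠ? y) ×-dec (T? (adj G x y) ×-dec (¬? ((x ≟ a) ×-dec (y ≟ c)) ×-dec ¬? ((x ≟ b) ×-dec (y ≟ c))))

  codeAB : Code a b
  codeAB = a<b , Aab , (λ { (_ , e) → <-irrefl e b<c }) , (λ { (e , _) → <-irrefl e a<b })

  codeInT⇒ab : ∀ {x y} → Code x y → inT x → inT y → x ≡ a × y ≡ b
  codeInT⇒ab (lt , _ , _ , _)  (inj₁ refl)        (inj₁ refl)        = ⊥-elim (<-irrefl refl lt)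
  codeInT⇒ab (lt , _ , _ , _)  (inj₁ refl)        (inj₂ (inj₁ refl)) = refl , refl
  codeInT⇒ab (lt , _ , ac , _) (inj₁ refl)        (inj₂ (inj₂ refl)) = ⊥-elim (ac (refl , refl))
  codeInT⇒ab (lt , _ , _ , _)  (inj₂ (inj₁ refl)) (inj₁ refl)        = ⊥-elim (<-asym lt a<b)
  codeInT⇒ab (lt , _ , _ , _)  (inj₂ (inj₁ refl)) (inj₂ (inj₁ refl)) = ⊥-elim (<-irrefl refl lt)
  codeInT⇒ab (lt , _ , _ , bc) (inj₂ (inj₁ refl)) (inj₂ (inj₂ refl)) = ⊥-elim (bc (refl , refl))
  codeInT⇒ab (lt , _ , _ , _)  (inj₂ (inj₂ refl)) (inj₁ refl)        = ⊥-elim (<-asym lt a<c)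
  codeInT⇒ab (lt , _ , _ , _)  (inj₂ (inj₂ refl)) (inj₂ (inj₁ refl)) = ⊥-elim (<-asym lt b<c)
  codeInT⇒ab (lt , _ , _ , _)  (inj₂ (inj₂ refl)) (inj₂ (inj₂ refl)) = ⊥-elim (<-irrefl refl lt)

  InClique : V → V → V → Set
  InClique x y u = u ≡ x ⊎ (u ≡ y ⊎ (x ≡ a × y ≡ b × u ≡ c))

  inClique? : ∀ x y u → Dec (InClique x y u)
  inClique? x y u = (u ≟ x) ⊎-dec ((u ≟ y) ⊎-dec ((x ≟ a) ×-dec ((y ≟ b) ×-dec (u ≟ c))))

  codeClique : ∀ {x y u v} → Code x y → InClique x y u → InClique x y v → u ≢ v → Adj G u v
  codeClique cd (inj₁ refl)                        (inj₁ refl)                        u≢v = ⊥-elim (u≢v refl)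
  codeClique cd (inj₁ refl)                        (inj₂ (inj₁ refl))                 _   = proj₁ (proj₂ cd)
  codeClique cd (inj₁ refl)                        (inj₂ (inj₂ (refl , refl , refl))) _   = Aac
  codeClique cd (inj₂ (inj₁ refl))                 (inj₁ refl)                        _   = adjSym (proj₁ (proj₂ cd))
  codeClique cd (inj₂ (inj₁ refl))                 (inj₂ (inj₁ refl))                 u≢v = ⊥-elim (u≢v refl)
  codeClique cd (inj₂ (inj₁ refl))                 (inj₂ (inj₂ (refl , refl , refl))) _   = Abc
  codeClique cd (inj₂ (inj₂ (refl , refl , refl))) (inj₁ refl)                        _   = adjSym Aac
  codeClique cd (inj₂ (inj₂ (refl , refl , refl))) (inj₂ (inj₁ refl))                 _   = adjSym Abc
  codeClique cd (inj₂ (inj₂ (refl , refl , refl))) (inj₂ (inj₂ (_ , _ , refl)))       u≢v = ⊥-elim (u≢v refl)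

  sortedEdge⇒code : ∀ {u v} → u <ᶠ v → Adj G u v → Σ V λ x → Σ V λ y → Code x y × InClique x y u × InClique x y v
  sortedEdge⇒code {u} {v} u<v uv with (u ≟ a) ×-dec (v ≟ c) | (u ≟ b) ×-dec (v ≟ c)
  ... | yes (refl , refl) | _                 = a , b , codeAB , inj₁ refl , inj₂ (inj₂ (refl , refl , refl))
  ... | no _              | yes (refl , refl) = a , b , codeAB , inj₂ (inj₁ refl) , inj₂ (inj₂ (refl , refl , refl))
  ... | no ¬ac            | no ¬bc            = u , v , (u<v , uv , ¬ac , ¬bc) , inj₁ refl , inj₂ (inj₁ refl)

  edge⇒code : ∀ {u v} → Adj G u v → Σ V λ x → Σ V λ y → Code x y × InClique x y u × InClique x y v
  edge⇒code {u} {v} uv with <-cmp u v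
  ... | tri< u<v _ _ = sortedEdge⇒code u<v uv
  ... | tri≈ _ e _   = ⊥-elim (adj≢ uv e)
  ... | tri> _ _ v<u with sortedEdge⇒code v<u (adjSym uv)
  ...   | x , y , cd , v∈ , u∈ = x , y , cd , u∈ , v∈

  -- If it contains the code xy and
  -- a vertex z outside {x, y}, then x, y, z form the triangle, so xy = ab
  -- and the clique lies inside T, where ab is the only code.
  module OneCodePerClique (InC : V → Set) (isClique : ∀ {p q} → InC p → InC q → p ≢ q → Adj G p q) where

    extraVertex : ∀ {x y z} → Code x y → InC x → InC y → InC z → z ≢ x → z ≢ y →
      inT x × inT y × inT z
    extraVertex cd x∈ y∈ z∈ z≢x z≢y =
      triangle⇒inT (proj₁ (proj₂ cd)) (isClique y∈ z∈ (λ e → z≢y (≡-sym e))) (isClique x∈ z∈ (λ e → z≢x (≡-sym e)))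

    insideT : ∀ {x y z} → Code x y → InC x → InC y → InC z → z ≢ x → z ≢ y → ∀ u → InC u → inT u
    insideT {x} {y} cd x∈ y∈ z∈ z≢x z≢y u u∈ with u ≟ x | u ≟ y
    ... | yes refl | _        = proj₁ (extraVertex cd x∈ y∈ z∈ z≢x z≢y)
    ... | no _     | yes refl = proj₁ (proj₂ (extraVertex cd x∈ y∈ z∈ z≢x z≢y))
    ... | no u≢x   | no u≢y   = proj₂ (proj₂ (extraVertex cd x∈ y∈ u∈ u≢x u≢y))

    bothAB : ∀ {x y x' y' z} → Code x y → Code x' y' → InC x → InC y → InC x' → InC y' →
      InC z → z ≢ x → z ≢ y → x ≡ x' × y ≡ y'
    bothAB {x} {y} {x'} {y'} cd cd' x∈ y∈ x'∈ y'∈ z∈ z≢x z≢y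
      with codeInT⇒ab cd (inside x x∈) (inside y y∈) | codeInT⇒ab cd' (inside x' x'∈) (inside y' y'∈)
      where
      inside : ∀ u → InC u → inT u
      inside = insideT cd x∈ y∈ z∈ z≢x z≢y
    ... | refl , refl | refl , refl = refl , refl

    sameCode : ∀ {x y x' y'} → Code x y → Code x' y' → InC x → InC y → InC x' → InC y' → x ≡ x' × y ≡ y'
    sameCode {x} {y} {x'} {y'} cd cd' x∈ y∈ x'∈ y'∈ with x' ≟ x | y' ≟ y
    ... | yes refl | yes refl = refl , refl
    ... | yes refl | no y'≢y  = bothAB cd cd' x∈ y∈ x'∈ y'∈ y'∈ (λ e → <-irrefl (≡-sym e) (proj₁ cd')) y'≢y
    ... | no x'≢x  | _ with x' ≟ y
    ...   | no x'≢y  = bothAB cd cd' x∈ y∈ x'∈ y'∈ x'∈ x'≢x x'≢y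
    ...   | yes refl = bothAB cd cd' x∈ y∈ x'∈ y'∈ y'∈
                         (λ e → <-asym (proj₁ cd) (subst (x' <ᶠ_) e (proj₁ cd')))
                         (λ e → <-irrefl (≡-sym e) (proj₁ cd'))

  2<n : 2 < n G
  2<n = ℕP.≤-trans (s≤s (ℕP.≤-trans (s≤s (ℕP.≤-trans (s≤s z≤n) a<b)) b<c)) (toℕ<n c)

  abstract
    codes : PairEnumeration Code
    codes = enumeratePairs Code code?

  open PairEnumeration codes public
    renaming (size to N; elem to code; elem-sat to code-valid; elem-inj to code-inj; elem-onto to code-surj)

  cx cy : Fin N → V
  cx i = proj₁ (code i)
  cy i = proj₂ (code i)

  Member : Fin N → V → Set
  Member i u = InClique (cx i) (cy i) u

  member? : ∀ i u → Dec (Member i u)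
  member? i u = inClique? (cx i) (cy i) u

  edgeCovered : ∀ {u v} → Adj G u v → Σ (Fin N) λ i → Member i u × Member i v
  edgeCovered uv with edge⇒code uv
  ... | x , y , cd , u∈ , v∈ with code-surj x y cd
  ...   | i , refl = i , u∈ , v∈

  memberClique : ∀ i {u v} → Member i u → Member i v → u ≢ v → Adj G u v
  memberClique i = codeClique (code-valid i)

  -- θ_E(G) = N: the cliques of the codes cover the edges, and any edge
  -- clique cover has a clique containing each code, no two codes sharing one.
  codeCover : HasEdgeCliqueCover G N
  codeCover = (λ i → subsetOf (member? i)) ,
    (λ i x y x∈ y∈ x≢y → memberClique i (∈-subsetOf⁻ (member? i) x∈) (∈-subsetOf⁻ (member? i) y∈) x≢y) ,
    (λ x y xy → let (i , x∈ , y∈) = edgeCovered xy in i , ∈-subsetOf⁺ (member? i) x∈ , ∈-subsetOf⁺ (member? i) y∈)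

  codeCover-minimal : ∀ θ → HasEdgeCliqueCover G θ → N ≤ θ
  codeCover-minimal θ (C , isClique , covers) = injective⇒≤ {f = cliqueOf} cliqueOf-inj
    where
    cliqueOf : Fin N → Fin θ
    cliqueOf i = proj₁ (covers (cx i) (cy i) (proj₁ (proj₂ (code-valid i))))
    cliqueOf-inj : ∀ {i j} → cliqueOf i ≡ cliqueOf j → i ≡ j
    cliqueOf-inj {i} {j} e = code-inj i j (cong₂ _,_ (proj₁ same) (proj₂ same))
      where
      ci : ∃ λ t → cx i ∈ C t × cy i ∈ C t
      ci = covers (cx i) (cy i) (proj₁ (proj₂ (code-valid i)))
      cj : ∃ λ t → cx j ∈ C t × cy j ∈ C t
      cj = covers (cx j) (cy j) (proj₁ (proj₂ (code-valid j)))
      same : cx i ≡ cx j × cy i ≡ cy j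
      same = OneCodePerClique.sameCode (λ u → u ∈ C (cliqueOf i)) (λ {p} {q} → isClique (cliqueOf i) p q)
               (code-valid i) (code-valid j) (proj₁ (proj₂ ci)) (proj₂ (proj₂ ci))
               (subst (λ t → cx j ∈ C t) (≡-sym e) (proj₁ (proj₂ cj)))
               (subst (λ t → cy j ∈ C t) (≡-sym e) (proj₂ (proj₂ cj)))

  cliqueCoverNumber : IsEdgeCliqueCoverNumber G N
  cliqueCoverNumber = codeCover , codeCover-minimal

-- Spanning-tree orderings of a connected graph: an enumeration ord 0, ord 1, …
-- of the vertices in which every vertex after the first has an earlier
-- neighbour, its parent.
module TreeOrderings (G : Graph) (connected : Connected G) where
  open GraphFacts G

  V : Set
  V = Fin (n G)

  record Prefix (l : ℕ) : Set where
    field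
      ord    : ℕ → V
      inj    : ∀ i j → i < l → j < l → ord i ≡ ord j → i ≡ j
      par    : ℕ → ℕ
      par<   : ∀ i → 0 < i → i < l → par i < i
      parAdj : ∀ i → 0 < i → i < l → Adj G (ord i) (ord (par i))

  Extends : ∀ {l l'} → Prefix l → Prefix l' → Set
  Extends {l} P Q = ∀ i → i < l → Prefix.ord P i ≡ Prefix.ord Q i × Prefix.par P i ≡ Prefix.par Q i

  extends-trans : ∀ {l₁ l₂ l₃} (P : Prefix l₁) (Q : Prefix l₂) (R : Prefix l₃) → l₁ ≤ l₂ →
    Extends P Q → Extends Q R → Extends P R
  extends-trans P Q R le pq qr i lt =
    trans (proj₁ (pq i lt)) (proj₁ (qr i (ℕP.<-≤-trans lt le))) ,
    trans (proj₂ (pq i lt)) (proj₂ (qr i (ℕP.<-≤-trans lt le)))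

  -- A nonempty prefix missing some vertex grows by one vertex: by
  -- connectivity some placed vertex has an unplaced neighbour w.
  module Grow {l : ℕ} (P : Prefix l) (l<n : l < n G) (0<l : 0 < l) where
    open Prefix P

    Placed : V → Set
    Placed v = ∃ λ (i : Fin l) → ord (toℕ i) ≡ v

    placed? : ∀ v → Dec (Placed v)
    placed? v = any? (λ i → ord (toℕ i) ≟ v)

    unplaced : ∃ λ y → ¬ Placed y
    unplaced = ¬∀⟶∃¬ (n G) Placed placed? allPlaced
      where
      allPlaced : ¬ (∀ v → Placed v)
      allPlaced h = ℕP.<-irrefl refl (ℕP.<-≤-trans l<n (injective⇒≤ {f = λ v → proj₁ (h v)} h-inj))
        where
        h-inj : ∀ {u v} → proj₁ (h u) ≡ proj₁ (h v) → u ≡ v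
        h-inj {u} {v} e = trans (≡-sym (proj₂ (h u))) (trans (cong (λ t → ord (toℕ t)) e) (proj₂ (h v)))

    leave : ∀ {u y} → Placed u → ¬ Placed y → Star (Adj G) u y →
      Σ (Fin l) λ p → Σ V λ w → ¬ Placed w × Adj G (ord (toℕ p)) w
    leave u∈ y∉ ε = ⊥-elim (y∉ u∈)
    leave (p , e) y∉ (_◅_ {j = u'} r walk) with placed? u'
    ... | yes u'∈ = leave u'∈ y∉ walk
    ... | no u'∉  = p , u' , u'∉ , subst (λ t → Adj G t u') (≡-sym e) r

    exit : Σ (Fin l) λ p → Σ V λ w → ¬ Placed w × Adj G (ord (toℕ p)) w
    exit = leave (fromℕ< 0<l , refl) (proj₂ unplaced) (connected _ (proj₁ unplaced))
    p : Fin l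
    p = proj₁ exit
    w : V
    w = proj₁ (proj₂ exit)
    w∉ : ¬ Placed w
    w∉ = proj₁ (proj₂ (proj₂ exit))
    pw : Adj G (ord (toℕ p)) w
    pw = proj₂ (proj₂ (proj₂ exit))

    ord' : ℕ → V
    ord' i with i ℕP.≟ l
    ... | yes _ = w
    ... | no _  = ord i
    par' : ℕ → ℕ
    par' i with i ℕP.≟ l
    ... | yes _ = toℕ p
    ... | no _  = par i

    ord'-old : ∀ i → i < l → ord' i ≡ ord i
    ord'-old i lt with i ℕP.≟ l
    ... | yes refl = ⊥-elim (ℕP.<-irrefl refl lt)
    ... | no _     = refl
    par'-old : ∀ i → i < l → par' i ≡ par i
    par'-old i lt with i ℕP.≟ l
    ... | yes refl = ⊥-elim (ℕP.<-irrefl refl lt)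
    ... | no _     = refl
    ord'-new : ord' l ≡ w
    ord'-new with l ℕP.≟ l
    ... | yes _ = refl
    ... | no ne = ⊥-elim (ne refl)
    par'-new : par' l ≡ toℕ p
    par'-new with l ℕP.≟ l
    ... | yes _ = refl
    ... | no ne = ⊥-elim (ne refl)

    oldOrNew : ∀ i → i < suc l → i < l ⊎ i ≡ l
    oldOrNew i lt = ℕP.m≤n⇒m<n∨m≡n (ℕP.≤-pred lt)

    notOld : ∀ i → i < l → ord i ≢ w
    notOld i lt e = w∉ (fromℕ< lt , trans (cong ord (toℕ-fromℕ< lt)) e)

    grown : Prefix (suc l)
    grown = record { ord = ord' ; inj = inj' ; par = par' ; par< = par<' ; parAdj = parAdj' }
      where
      inj' : ∀ i j → i < suc l → j < suc l → ord' i ≡ ord' j → i ≡ j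
      inj' i j li lj e with oldOrNew i li | oldOrNew j lj
      ... | inj₁ i< | inj₁ j< = inj i j i< j< (trans (≡-sym (ord'-old i i<)) (trans e (ord'-old j j<)))
      ... | inj₁ i< | inj₂ refl = ⊥-elim (notOld i i< (trans (≡-sym (ord'-old i i<)) (trans e ord'-new)))
      ... | inj₂ refl | inj₁ j< = ⊥-elim (notOld j j< (trans (≡-sym (ord'-old j j<)) (trans (≡-sym e) ord'-new)))
      ... | inj₂ refl | inj₂ refl = refl
      par<' : ∀ i → 0 < i → i < suc l → par' i < i
      par<' i pos li with oldOrNew i li
      ... | inj₁ i<    = subst (_< i) (≡-sym (par'-old i i<)) (par< i pos i<)
      ... | inj₂ refl  = subst (_< l) (≡-sym par'-new) (toℕ<n p)
      parAdj' : ∀ i → 0 < i → i < suc l → Adj G (ord' i) (ord' (par' i))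
      parAdj' i pos li with oldOrNew i li
      ... | inj₁ i< = subst₂ (Adj G) (≡-sym (ord'-old i i<))
              (trans (≡-sym (ord'-old (par i) (ℕP.<-trans (par< i pos i<) i<))) (cong ord' (≡-sym (par'-old i i<))))
              (parAdj i pos i<)
      ... | inj₂ refl = subst₂ (Adj G) (≡-sym ord'-new)
              (trans (≡-sym (ord'-old (toℕ p) (toℕ<n p))) (cong ord' (≡-sym par'-new)))
              (adjSym pw)

    extends : Extends P grown
    extends i lt = ≡-sym (ord'-old i lt) , ≡-sym (par'-old i lt)

  growBy : ∀ d {l} → d + l ≡ n G → (P : Prefix l) → 0 < l → Σ (Prefix (n G)) (Extends P)
  growBy zero    refl P _   = P , λ i _ → refl , refl
  growBy (suc d) {l} e P 0<l =
    proj₁ rest , extends-trans P (Grow.grown P l<n 0<l) (proj₁ rest) (ℕP.n≤1+n l) (Grow.extends P l<n 0<l) (proj₂ rest)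
    where
    l<n : l < n G
    l<n = subst (l <_) e (s≤s (ℕP.m≤n+m l d))
    rest : Σ (Prefix (n G)) (Extends (Grow.grown P l<n 0<l))
    rest = growBy d {suc l} (trans (ℕP.+-suc d l) e) (Grow.grown P l<n 0<l) (s≤s z≤n)

  record TreeOrdering : Set where
    field
      ord     : ℕ → V
      pos     : V → ℕ
      pos<n   : ∀ v → pos v < n G
      ord-pos : ∀ v → ord (pos v) ≡ v
      pos-ord : ∀ i → i < n G → pos (ord i) ≡ i
      par     : V → V
      parAdj  : ∀ v → 0 < pos v → Adj G v (par v)
      par<    : ∀ v → 0 < pos v → pos (par v) < pos v

  -- A prefix of full length is a complete ordering: ord is then a
  -- bijection onto V, and pos is its inverse.
  complete : Prefix (n G) → TreeOrdering
  complete P = record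
    { ord = ord ; pos = pos ; pos<n = λ v → toℕ<n (index v) ; ord-pos = λ v → proj₂ (onto v)
    ; pos-ord = pos-ord ; par = λ v → ord (par (pos v))
    ; parAdj = λ v lt → subst (λ t → Adj G t (ord (par (pos v)))) (proj₂ (onto v)) (parAdj (pos v) lt (toℕ<n (index v)))
    ; par< = par<ᵛ }
    where
    open Prefix P
    ordᶠ : Fin (n G) → V
    ordᶠ i = ord (toℕ i)
    onto : ∀ v → ∃ λ i → ordᶠ i ≡ v
    onto = injective⇒surjective ordᶠ (λ i j e → toℕ-injective (inj (toℕ i) (toℕ j) (toℕ<n i) (toℕ<n j) e))
    index : V → Fin (n G)
    index v = proj₁ (onto v)
    pos : V → ℕ
    pos v = toℕ (index v)
    pos-ord : ∀ i → i < n G → pos (ord i) ≡ i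
    pos-ord i lt = inj _ _ (toℕ<n (index (ord i))) lt (proj₂ (onto (ord i)))
    par<ᵛ : ∀ v → 0 < pos v → pos (ord (par (pos v))) < pos v
    par<ᵛ v lt = subst (_< pos v) (≡-sym (pos-ord _ (ℕP.<-trans par<v (toℕ<n (index v))))) par<v
      where
      par<v : par (pos v) < pos v
      par<v = par< (pos v) lt (toℕ<n (index v))

  record TreeOrderingAlong (p : ℕ → V) (L : ℕ) : Set where
    field
      ordering : TreeOrdering
      along    : ∀ i → i ≤ L → TreeOrdering.ord ordering i ≡ p i
      alongPar : ∀ i → i < L → TreeOrdering.par ordering (p (suc i)) ≡ p i

  -- Every path on fewer than n vertices starts a tree ordering.
  -- (Abstract: the ordering is only used through its specification.)
  abstract
    treeOrderingAlong : (p : ℕ → V) (L : ℕ) → L < n G → (∀ i j → i ≤ L → j ≤ L → p i ≡ p j → i ≡ j) →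
      (∀ i → i < L → Adj G (p (suc i)) (p i)) → TreeOrderingAlong p L
    treeOrderingAlong p L L<n inj adj = record { ordering = O ; along = along ; alongPar = alongPar }
      where
      pathPrefix : Prefix (suc L)
      pathPrefix = record
        { ord = p ; inj = λ i j li lj → inj i j (ℕP.≤-pred li) (ℕP.≤-pred lj) ; par = pred
        ; par< = λ { (suc i) _ _ → ℕP.n<1+n i } ; parAdj = λ { (suc i) _ lt → adj i (ℕP.≤-pred lt) } }
      full : Σ (Prefix (n G)) (Extends pathPrefix)
      full = growBy (n G ∸ suc L) (ℕP.m∸n+n≡m L<n) pathPrefix (s≤s z≤n)
      Q : Prefix (n G)
      Q = proj₁ full
      O : TreeOrdering
      O = complete Q
      along : ∀ i → i ≤ L → TreeOrdering.ord O i ≡ p i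
      along i le = ≡-sym (proj₁ (proj₂ full i (s≤s le)))
      alongPar : ∀ i → i < L → TreeOrdering.par O (p (suc i)) ≡ p i
      alongPar i lt = begin
        Prefix.ord Q (Prefix.par Q (TreeOrdering.pos O (p (suc i))))
          ≡⟨ cong (λ v → Prefix.ord Q (Prefix.par Q (TreeOrdering.pos O v))) (≡-sym (along (suc i) lt)) ⟩
        Prefix.ord Q (Prefix.par Q (TreeOrdering.pos O (TreeOrdering.ord O (suc i))))
          ≡⟨ cong (λ t → Prefix.ord Q (Prefix.par Q t)) (TreeOrdering.pos-ord O (suc i) (ℕP.<-≤-trans (s≤s lt) L<n)) ⟩
        Prefix.ord Q (Prefix.par Q (suc i))
          ≡⟨ cong (Prefix.ord Q) (≡-sym (proj₂ (proj₂ full (suc i) (s≤s lt)))) ⟩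
        Prefix.ord Q i
          ≡⟨ along i (ℕP.<⇒≤ lt) ⟩
        p i ∎
        where open ≡-Reasoning

-- Cycles of length m + 1 ≥ 4, as sequences q 0, …, q m on ℕ.
module Cycles (G : Graph) where
  open GraphFacts G

  V : Set
  V = Fin (n G)

  record Cycle : Set where
    field
      m     : ℕ
      q     : ℕ → V
      m≥3   : 3 ≤ m
      inj   : ∀ i j → i ≤ m → j ≤ m → q i ≡ q j → i ≡ j
      step  : ∀ i → i < m → Adj G (q i) (q (suc i))
      close : Adj G (q m) (q 0)

  cycleOf : HasCycleOfLengthAtLeast4 G → Cycle
  cycleOf (m , m≥3 , w , w-inj , w-step , w-close) =
    record { m = m ; q = q ; m≥3 = m≥3 ; inj = inj ; step = step ; close = close }
    where
    q : ℕ → V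
    q j with j ℕP.<? suc m
    ... | yes lt = w (fromℕ< lt)
    ... | no _   = w zero
    q-at : ∀ j (k : Fin (suc m)) → toℕ k ≡ j → q j ≡ w k
    q-at j k e with j ℕP.<? suc m
    ... | yes lt = cong w (toℕ-injective (trans (toℕ-fromℕ< lt) (≡-sym e)))
    ... | no ¬lt = ⊥-elim (¬lt (subst (_< suc m) e (toℕ<n k)))
    inj : ∀ i j → i ≤ m → j ≤ m → q i ≡ q j → i ≡ j
    inj i j li lj e = begin
      i                      ≡⟨ ≡-sym (toℕ-fromℕ< (s≤s li)) ⟩
      toℕ (fromℕ< (s≤s li)) ≡⟨ cong toℕ (w-inj (trans (≡-sym (q-at i _ (toℕ-fromℕ< (s≤s li))))
                                                   (trans e (q-at j _ (toℕ-fromℕ< (s≤s lj)))))) ⟩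
      toℕ (fromℕ< (s≤s lj)) ≡⟨ toℕ-fromℕ< (s≤s lj) ⟩
      j                      ∎
      where open ≡-Reasoning
    step : ∀ i → i < m → Adj G (q i) (q (suc i))
    step i lt = subst₂ (Adj G)
      (≡-sym (q-at i (inject₁ (fromℕ< lt)) (trans (toℕ-inject₁ (fromℕ< lt)) (toℕ-fromℕ< lt))))
      (≡-sym (q-at (suc i) (suc (fromℕ< lt)) (cong suc (toℕ-fromℕ< lt))))
      (w-step (fromℕ< lt))
    close : Adj G (q m) (q 0)
    close = subst₂ (Adj G) (≡-sym (q-at m (fromℕ m) (toℕ-fromℕ m))) (≡-sym (q-at 0 zero refl)) w-close

  shifted : (ℕ → V) → ℕ → ℕ → V
  shifted q m j with j ℕP.<? m
  ... | yes _ = q (suc j)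
  ... | no _  = q 0

  shifted-< : ∀ q m j → j < m → shifted q m j ≡ q (suc j)
  shifted-< q m j lt with j ℕP.<? m
  ... | yes _  = refl
  ... | no ¬lt = ⊥-elim (¬lt lt)

  shifted-m : ∀ q m → shifted q m m ≡ q 0
  shifted-m q m with m ℕP.<? m
  ... | yes lt = ⊥-elim (ℕP.<-irrefl refl lt)
  ... | no _   = refl

  rotate : Cycle → Cycle
  rotate C = record { m = m ; q = shifted q m ; m≥3 = m≥3 ; inj = inj' ; step = step' ; close = close' }
    where
    open Cycle C
    inj' : ∀ i j → i ≤ m → j ≤ m → shifted q m i ≡ shifted q m j → i ≡ j
    inj' i j li lj e with ℕP.m≤n⇒m<n∨m≡n li | ℕP.m≤n⇒m<n∨m≡n lj
    ... | inj₁ i< | inj₁ j< = ℕP.suc-injective (inj _ _ i< j< (trans (≡-sym (shifted-< q m i i<)) (trans e (shifted-< q m j j<))))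
    ... | inj₁ i< | inj₂ refl with inj _ _ i< z≤n (trans (≡-sym (shifted-< q m i i<)) (trans e (shifted-m q m)))
    ...   | ()
    inj' i j li lj e | inj₂ refl | inj₁ j< with inj _ _ z≤n j< (trans (≡-sym (shifted-m q m)) (trans e (shifted-< q m j j<)))
    ...   | ()
    inj' i j li lj e | inj₂ refl | inj₂ refl = refl
    step' : ∀ i → i < m → Adj G (shifted q m i) (shifted q m (suc i))
    step' i lt with ℕP.m≤n⇒m<n∨m≡n lt
    ... | inj₁ i+1< = subst₂ (Adj G) (≡-sym (shifted-< q m i lt)) (≡-sym (shifted-< q m (suc i) i+1<)) (step (suc i) i+1<)
    ... | inj₂ refl = subst₂ (Adj G) (≡-sym (shifted-< q m i lt)) (≡-sym (shifted-m q m)) close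
    close' : Adj G (shifted q m m) (shifted q m 0)
    close' = subst₂ (Adj G) (≡-sym (shifted-m q m)) (≡-sym (shifted-< q m 0 0<m)) (step 0 0<m)
      where
      0<m : 0 < m
      0<m = ℕP.<-≤-trans (s≤s z≤n) m≥3

  rotateBy : ℕ → Cycle → Cycle
  rotateBy zero    C = C
  rotateBy (suc s) C = rotateBy s (rotate C)

  rotateBy-q : ∀ s C j → j + s ≤ Cycle.m C → Cycle.q (rotateBy s C) j ≡ Cycle.q C (j + s)
  rotateBy-q zero    C j le = cong (Cycle.q C) (≡-sym (ℕP.+-identityʳ j))
  rotateBy-q (suc s) C j le = begin
    Cycle.q (rotateBy s (rotate C)) j ≡⟨ rotateBy-q s (rotate C) j (ℕP.<⇒≤ j+s<m) ⟩
    shifted (Cycle.q C) (Cycle.m C) (j + s) ≡⟨ shifted-< (Cycle.q C) (Cycle.m C) (j + s) j+s<m ⟩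
    Cycle.q C (suc (j + s)) ≡⟨ cong (Cycle.q C) (≡-sym (ℕP.+-suc j s)) ⟩
    Cycle.q C (j + suc s) ∎
    where
    open ≡-Reasoning
    j+s<m : j + s < Cycle.m C
    j+s<m = subst (_≤ Cycle.m C) (ℕP.+-suc j s) le

  rotateBy-m-0 : ∀ C → Cycle.q (rotateBy (Cycle.m C) C) 0 ≡ Cycle.q C (Cycle.m C)
  rotateBy-m-0 C = rotateBy-q (Cycle.m C) C 0 ℕP.≤-refl

  rotateBy-m-1 : ∀ C → Cycle.q (rotateBy (Cycle.m C) C) 1 ≡ Cycle.q C 0
  rotateBy-m-1 C with Cycle.m C in m≡
  ... | zero  = ⊥-elim (ℕP.<-irrefl refl (ℕP.<-≤-trans (s≤s z≤n) (subst (3 ≤_) m≡ (Cycle.m≥3 C))))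
  ... | suc k = begin
    Cycle.q (rotateBy k (rotate C)) 1 ≡⟨ rotateBy-q k (rotate C) 1 (ℕP.≤-reflexive (≡-sym m≡)) ⟩
    shifted (Cycle.q C) (Cycle.m C) (suc k) ≡⟨ cong (shifted (Cycle.q C) (Cycle.m C)) (≡-sym m≡) ⟩
    shifted (Cycle.q C) (Cycle.m C) (Cycle.m C) ≡⟨ shifted-m (Cycle.q C) (Cycle.m C) ⟩
    Cycle.q C 0 ∎
    where open ≡-Reasoning

-- A cycle of length ≥ 4 can be rotated so that it either avoids T or leaves
-- T at its first step (q 0 ∈ T, q 1 ∉ T).  Otherwise membership in T would
-- propagate all the way round the cycle, putting four vertices into T.
module Normalise (G : Graph) (a b c : Fin (n G)) (tri : IsTriangle G a b c)
    (uniq : ∀ x y z → IsTriangle G x y z → (x ≡ a × y ≡ b × z ≡ c)) where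
  open UniqueTriangle G a b c tri uniq
  open Cycles G hiding (V)

  Normalised : Cycle → Set
  Normalised C = (inT (Cycle.q C 0) × ¬ inT (Cycle.q C 1)) ⊎ (∀ j → j ≤ Cycle.m C → ¬ inT (Cycle.q C j))

  closedUnderSteps⇒avoidsT : (C : Cycle) → let open Cycle C in
    (∀ s → s < m → inT (q s) → inT (q (suc s))) → (inT (q m) → inT (q 0)) →
    ∀ j → j ≤ m → ¬ inT (q j)
  closedUnderSteps⇒avoidsT C forward wrap j j≤m qj∈T =
    noFourInT (allInT 0 z≤n) (allInT 1 1≤3) (allInT 2 2≤3) (allInT 3 3≤3)
      (distinct 0 1 z≤n 1≤3 (λ ())) (distinct 0 2 z≤n 2≤3 (λ ())) (distinct 0 3 z≤n 3≤3 (λ ()))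
      (distinct 1 2 1≤3 2≤3 (λ ())) (distinct 1 3 1≤3 3≤3 (λ ())) (distinct 2 3 2≤3 3≤3 (λ ()))
    where
    open Cycle C
    onwards : ∀ d i → inT (q i) → d + i ≤ m → inT (q (d + i))
    onwards zero    i t _  = t
    onwards (suc d) i t le = subst (λ k → inT (q k)) (ℕP.+-suc d i)
      (onwards d (suc i) (forward i (ℕP.<-≤-trans (ℕP.m<n+m i (s≤s z≤n)) le) t) (subst (_≤ m) (≡-sym (ℕP.+-suc d i)) le))
    qm∈T : inT (q m)
    qm∈T = subst (λ k → inT (q k)) (ℕP.m∸n+n≡m j≤m) (onwards (m ∸ j) j qj∈T (ℕP.≤-reflexive (ℕP.m∸n+n≡m j≤m)))
    allInT : ∀ k → k ≤ 3 → inT (q k)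
    allInT k k≤3 = subst (λ t → inT (q t)) (ℕP.+-identityʳ k)
      (onwards k 0 (wrap qm∈T) (subst (_≤ m) (≡-sym (ℕP.+-identityʳ k)) (ℕP.≤-trans k≤3 m≥3)))
    1≤3 : 1 ≤ 3
    1≤3 = s≤s z≤n
    2≤3 : 2 ≤ 3
    2≤3 = s≤s (s≤s z≤n)
    3≤3 : 3 ≤ 3
    3≤3 = ℕP.≤-refl
    distinct : ∀ i k → i ≤ 3 → k ≤ 3 → i ≢ k → q i ≢ q k
    distinct i k i≤3 k≤3 i≢k e = i≢k (inj i k (ℕP.≤-trans i≤3 m≥3) (ℕP.≤-trans k≤3 m≥3) e)

  normalise : Cycle → Σ Cycle Normalised
  normalise C with any? (λ (s : Fin (Cycle.m C)) → inT? (Cycle.q C (toℕ s)) ×-dec ¬? (inT? (Cycle.q C (suc (toℕ s)))))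
  ... | yes (s , s∈T , s+1∉T) = rotateBy (toℕ s) C ,
    inj₁ (subst inT (≡-sym (rotateBy-q (toℕ s) C 0 (ℕP.<⇒≤ (toℕ<n s)))) s∈T ,
          subst (λ v → ¬ inT v) (≡-sym (rotateBy-q (toℕ s) C 1 (toℕ<n s))) s+1∉T)
  ... | no noExit with inT? (Cycle.q C (Cycle.m C)) ×-dec ¬? (inT? (Cycle.q C 0))
  ...   | yes (m∈T , 0∉T) = rotateBy (Cycle.m C) C ,
    inj₁ (subst inT (≡-sym (rotateBy-m-0 C)) m∈T , subst (λ v → ¬ inT v) (≡-sym (rotateBy-m-1 C)) 0∉T)
  ...   | no noWrapExit = C , inj₂ (closedUnderSteps⇒avoidsT C forward wrap)
    where
    open Cycle C
    forward : ∀ s → s < m → inT (q s) → inT (q (suc s))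
    forward s lt s∈T with inT? (q (suc s))
    ... | yes s+1∈T = s+1∈T
    ... | no s+1∉T  = ⊥-elim (noExit (fromℕ< lt ,
          subst (λ k → inT (q k) × ¬ inT (q (suc k))) (≡-sym (toℕ-fromℕ< lt)) (s∈T , s+1∉T)))
    wrap : inT (q m) → inT (q 0)
    wrap m∈T with inT? (q 0)
    ... | yes 0∈T = 0∈T
    ... | no 0∉T  = ⊥-elim (noWrapExit (m∈T , 0∉T))

-- Take a
-- spanning-tree ordering starting with the path a, b, c.  If every code
-- other than ab were a tree edge, the map sending it to the position of its
-- later end (which is at least 3) minus 2, and ab to 0, would inject the
-- codes into {0, …, n − 3}.  So some code xy ≠ ab is not a tree edge, and
-- the tree path from x to y closes a cycle with xy; it is not the triangle,
-- so it has length at least four.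
module LongCycleFromManyCodes (G : Graph) (connected : Connected G) (a b c : Fin (n G))
    (tri : IsTriangle G a b c) (uniq : ∀ x y z → IsTriangle G x y z → (x ≡ a × y ≡ b × z ≡ c)) where
  open UniqueTriangle G a b c tri uniq
  open TreeOrderings G connected hiding (V)

  a≢b : a ≢ b
  a≢b e = <-irrefl e a<b
  b≢c : b ≢ c
  b≢c e = <-irrefl e b<c
  a≢c : a ≢ c
  a≢c e = <-irrefl e a<c

  path : ℕ → V
  path 0 = a
  path 1 = b
  path _ = c

  path-inj : ∀ i j → i ≤ 2 → j ≤ 2 → path i ≡ path j → i ≡ j
  path-inj 0 0 _ _ _ = refl
  path-inj 0 1 _ _ e = ⊥-elim (a≢b e)
  path-inj 0 2 _ _ e = ⊥-elim (a≢c e)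
  path-inj 1 0 _ _ e = ⊥-elim (a≢b (≡-sym e))
  path-inj 1 1 _ _ _ = refl
  path-inj 1 2 _ _ e = ⊥-elim (b≢c e)
  path-inj 2 0 _ _ e = ⊥-elim (a≢c (≡-sym e))
  path-inj 2 1 _ _ e = ⊥-elim (b≢c (≡-sym e))
  path-inj 2 2 _ _ _ = refl
  path-inj (suc (suc (suc i))) _ (s≤s (s≤s ())) _ _
  path-inj 0 (suc (suc (suc i))) _ (s≤s (s≤s ())) _
  path-inj 1 (suc (suc (suc i))) _ (s≤s (s≤s ())) _
  path-inj 2 (suc (suc (suc i))) _ (s≤s (s≤s ())) _

  path-adj : ∀ i → i < 2 → Adj G (path (suc i)) (path i)
  path-adj 0 _ = adjSym Aab
  path-adj 1 _ = adjSym Abc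
  path-adj (suc (suc i)) (s≤s (s≤s ()))

  open TreeOrderingAlong (treeOrderingAlong path 2 2<n path-inj path-adj)
  open TreeOrdering ordering

  TreeEdge : V → V → Set
  TreeEdge x y = (0 < pos x × par x ≡ y) ⊎ (0 < pos y × par y ≡ x)

  treeEdge? : ∀ x y → Dec (TreeEdge x y)
  treeEdge? x y = ((0 ℕP.<? pos x) ×-dec (par x ≟ y)) ⊎-dec ((0 ℕP.<? pos y) ×-dec (par y ≟ x))

  IsAB : Fin N → Set
  IsAB i = cx i ≡ a × cy i ≡ b

  isAB? : ∀ i → Dec (IsAB i)
  isAB? i = (cx i ≟ a) ×-dec (cy i ≟ b)

  later : V → V → ℕ
  later x y = pos x ⊔ pos y

  Child : V → V → V → Set
  Child x y w = 0 < pos w × later x y ≡ pos w × ((x ≡ w × y ≡ par w) ⊎ (y ≡ w × x ≡ par w))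

  child : ∀ {x y} → TreeEdge x y → Σ V (Child x y)
  child {x} {y} (inj₁ (lt , refl)) = x , lt , ℕP.m≥n⇒m⊔n≡m (ℕP.<⇒≤ (par< x lt)) , inj₁ (refl , refl)
  child {x} {y} (inj₂ (lt , refl)) = y , lt , ℕP.m≤n⇒m⊔n≡n (ℕP.<⇒≤ (par< y lt)) , inj₂ (refl , refl)

  endsInT : ∀ {x y w} → ((x ≡ w × y ≡ par w) ⊎ (y ≡ w × x ≡ par w)) → inT w → inT (par w) → inT x × inT y
  endsInT (inj₁ (refl , refl)) tw tp = tw , tp
  endsInT (inj₂ (refl , refl)) tw tp = tp , tw

  -- The tree edges at positions 1 and 2 are ab and bc; so a tree edge
  -- carrying a code other than ab has its child at position at least 3.
  late : ∀ i → ¬ IsAB i → TreeEdge (cx i) (cy i) → 3 ≤ later (cx i) (cy i)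
  late i ¬ab t with child t
  ... | w , 0<w , later≡ , ends = atPosition (pos w) refl
    where
    vertexAt : ∀ k → pos w ≡ k → k ≤ 2 → w ≡ path k
    vertexAt k e le = trans (≡-sym (ord-pos w)) (trans (cong ord e) (along k le))
    atPosition : ∀ k → pos w ≡ k → 3 ≤ later (cx i) (cy i)
    atPosition 0 e = ⊥-elim (ℕP.<-irrefl (≡-sym e) 0<w)
    atPosition 1 e = ⊥-elim (¬ab (uncurry (codeInT⇒ab (code-valid i))
      (endsInT ends (subst inT (≡-sym w≡b) bT) (subst inT (≡-sym (trans (cong par w≡b) (alongPar 0 (s≤s z≤n)))) aT))))
      where
      w≡b : w ≡ b
      w≡b = vertexAt 1 e (s≤s z≤n)
    atPosition 2 e = ⊥-elim (¬ab (uncurry (codeInT⇒ab (code-valid i))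
      (endsInT ends (subst inT (≡-sym w≡c) cT) (subst inT (≡-sym (trans (cong par w≡c) (alongPar 1 (s≤s (s≤s z≤n))))) bT))))
      where
      w≡c : w ≡ c
      w≡c = vertexAt 2 e ℕP.≤-refl
    atPosition (suc (suc (suc k))) e = subst (3 ≤_) (≡-sym (trans later≡ e)) (s≤s (s≤s (s≤s z≤n)))

  sameChild⇒sameEdge : ∀ {x y x' y' w w'} → x <ᶠ y → x' <ᶠ y' → Child x y w → Child x' y' w' →
    later x y ≡ later x' y' → x ≡ x' × y ≡ y'
  sameChild⇒sameEdge {x} {y} {x'} {y'} {w} {w'} x<y x'<y' (_ , l≡ , ends) (_ , l≡' , ends') l≡l'
    with trans (≡-sym (ord-pos w)) (trans (cong ord (trans (≡-sym l≡) (trans l≡l' l≡'))) (ord-pos w'))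
  ... | refl = sortedEnds ends ends'
    where
    sortedEnds : ((x ≡ w × y ≡ par w) ⊎ (y ≡ w × x ≡ par w)) → ((x' ≡ w × y' ≡ par w) ⊎ (y' ≡ w × x' ≡ par w)) →
      x ≡ x' × y ≡ y'
    sortedEnds (inj₁ (refl , refl)) (inj₁ (refl , refl)) = refl , refl
    sortedEnds (inj₁ (refl , refl)) (inj₂ (refl , refl)) = ⊥-elim (<-asym x<y x'<y')
    sortedEnds (inj₂ (refl , refl)) (inj₁ (refl , refl)) = ⊥-elim (<-asym x<y x'<y')
    sortedEnds (inj₂ (refl , refl)) (inj₂ (refl , refl)) = refl , refl

  allTreeEdges⇒fewCodes : (∀ i → ¬ IsAB i → TreeEdge (cx i) (cy i)) → N ≤ n G ∸ 2
  allTreeEdges⇒fewCodes treeEdge = boundedInjection⇒≤ (λ i → slot i (isAB? i)) (λ i → slot< i (isAB? i))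
    (λ i j → slot-inj i j (isAB? i) (isAB? j))
    where
    slot : ∀ i → Dec (IsAB i) → ℕ
    slot i (yes _) = 0
    slot i (no _)  = later (cx i) (cy i) ∸ 2
    late' : ∀ i → ¬ IsAB i → 2 < later (cx i) (cy i)
    late' i ¬ab = late i ¬ab (treeEdge i ¬ab)
    slot< : ∀ i d → slot i d < n G ∸ 2
    slot< i (yes _)  = ℕP.∸-monoˡ-< {2} {2} {n G} 2<n ℕP.≤-refl
    slot< i (no ¬ab) with child (treeEdge i ¬ab)
    ... | w , _ , later≡ , _ =
      ℕP.∸-monoˡ-< (subst (_< n G) (≡-sym later≡) (pos<n w)) (ℕP.<⇒≤ (late' i ¬ab))
    slot-inj : ∀ i j di dj → slot i di ≡ slot j dj → i ≡ j
    slot-inj i j (yes (e₁ , e₂)) (yes (e₁' , e₂')) _ = code-inj i j (cong₂ _,_ (trans e₁ (≡-sym e₁')) (trans e₂ (≡-sym e₂')))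
    slot-inj i j (yes _) (no ¬ab) e = ⊥-elim (ℕP.<-irrefl e (ℕP.∸-monoˡ-< {2} {2} (late' j ¬ab) ℕP.≤-refl))
    slot-inj i j (no ¬ab) (yes _) e = ⊥-elim (ℕP.<-irrefl (≡-sym e) (ℕP.∸-monoˡ-< {2} {2} (late' i ¬ab) ℕP.≤-refl))
    slot-inj i j (no ¬ab) (no ¬ab') e =
      code-inj i j (uncurry (cong₂ _,_) (sameChild⇒sameEdge (proj₁ (code-valid i)) (proj₁ (code-valid j))
        (proj₂ (child (treeEdge i ¬ab))) (proj₂ (child (treeEdge j ¬ab')))
        (ℕP.∸-cancelʳ-≡ (ℕP.<⇒≤ (late' i ¬ab)) (ℕP.<⇒≤ (late' j ¬ab')) e)))

  -- A code xy ≠ ab which is not a tree edge lies on a cycle of length ≥ 4: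
  -- the tree joins x and y without using the edge xy, and a shortest such
  -- connection, closed by xy, is a cycle; it has length ≥ 4 because x and y
  -- have no common neighbour (else x, y ∈ T and xy = ab).
  module NonTreeCode (x y : V) (code-xy : Code x y) (¬ab : ¬ (x ≡ a × y ≡ b)) (¬tree : ¬ TreeEdge x y) where

    Adj⁻ : V → V → Set
    Adj⁻ u v = Adj G u v × ¬ (u ≡ x × v ≡ y) × ¬ (u ≡ y × v ≡ x)

    adj⁻-sym : ∀ {u v} → Adj⁻ u v → Adj⁻ v u
    adj⁻-sym (uv , ¬xy , ¬yx) = adjSym uv , (λ { (e₁ , e₂) → ¬yx (e₂ , e₁) }) , (λ { (e₁ , e₂) → ¬xy (e₂ , e₁) })

    toRoot : ∀ k u → pos u < k → Star Adj⁻ u a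
    toRoot (suc k) u lt with 0 ℕP.<? pos u
    ... | no ¬0<u = subst (λ t → Star Adj⁻ t a) u≡a ε
      where
      u≡a : a ≡ u
      u≡a = trans (≡-sym (along 0 z≤n)) (trans (cong ord (≡-sym (ℕP.n≤0⇒n≡0 (ℕP.≮⇒≥ ¬0<u)))) (ord-pos u))
    ... | yes 0<u = (parAdj u 0<u , notXY , notYX) ◅ toRoot k (par u) (ℕP.<-≤-trans (par< u 0<u) (ℕP.≤-pred lt))
      where
      notXY : ¬ (u ≡ x × par u ≡ y)
      notXY (refl , e) = ¬tree (inj₁ (0<u , e))
      notYX : ¬ (u ≡ y × par u ≡ x)
      notYX (refl , e) = ¬tree (inj₂ (0<u , e))

    walk : Star Adj⁻ x y
    walk = toRoot (n G) x (pos<n x) ◅◅ reverseStar adj⁻-sym (toRoot (n G) y (pos<n y))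

    closeCycle : SimplePath Adj⁻ x y → HasCycleOfLengthAtLeast4 G
    closeCycle P = byLength L refl
      where
      open SimplePath P
      byLength : ∀ k → L ≡ k → HasCycleOfLengthAtLeast4 G
      byLength 0 e = ⊥-elim (<-irrefl (trans (≡-sym f0) (trans (cong f (≡-sym e)) fL)) (proj₁ code-xy))
      byLength 1 e = ⊥-elim (proj₁ (proj₂ (step 0 (subst (0 <_) (≡-sym e) (s≤s z≤n)))) (f0 , trans (cong f (≡-sym e)) fL))
      byLength 2 e = ⊥-elim (¬ab (codeInT⇒ab code-xy (proj₁ xzy) (proj₂ (proj₂ xzy))))
        where
        xz : Adj G x (f 1)
        xz = subst (λ t → Adj G t (f 1)) f0 (proj₁ (step 0 (subst (0 <_) (≡-sym e) (s≤s z≤n))))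
        zy : Adj G (f 1) y
        zy = subst (Adj G (f 1)) (trans (cong f (≡-sym e)) fL) (proj₁ (step 1 (subst (1 <_) (≡-sym e) (s≤s (s≤s z≤n)))))
        xzy : inT x × inT (f 1) × inT y
        xzy = triangle⇒inT xz zy (proj₁ (proj₂ code-xy))
      byLength (suc (suc (suc k))) e = L , subst (3 ≤_) (≡-sym e) (s≤s (s≤s (s≤s z≤n))) , v , v-inj , v-step , v-close
        where
        v : Fin (suc L) → V
        v j = f (toℕ j)
        v-inj : ∀ {i j} → v i ≡ v j → i ≡ j
        v-inj {i} {j} e = toℕ-injective (inj (toℕ i) (toℕ j) (ℕP.≤-pred (toℕ<n i)) (ℕP.≤-pred (toℕ<n j)) e)
        v-step : ∀ (i : Fin L) → Adj G (v (inject₁ i)) (v (suc i))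
        v-step i = subst (λ t → Adj G (f t) (f (suc (toℕ i)))) (≡-sym (toℕ-inject₁ i)) (proj₁ (step (toℕ i) (toℕ<n i)))
        v-close : Adj G (v (fromℕ L)) (v zero)
        v-close = subst₂ (Adj G) (trans (≡-sym fL) (cong f (≡-sym (toℕ-fromℕ L)))) (≡-sym f0) (adjSym (proj₁ (proj₂ code-xy)))

    longCycle : HasCycleOfLengthAtLeast4 G
    longCycle = closeCycle (simplePath walk)

  manyCodes⇒longCycle : n G ≤ suc N → HasCycleOfLengthAtLeast4 G
  manyCodes⇒longCycle many with all? (λ i → ¬? (isAB? i) →-dec treeEdge? (cx i) (cy i))
  ... | yes allTree = ⊥-elim (ℕP.<-irrefl refl (ℕP.≤-<-trans many (ℕP.≤-<-trans (s≤s (allTreeEdges⇒fewCodes allTree)) (suc[n∸2]<n 2<n))))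
    where
    suc[n∸2]<n : ∀ {m} → 2 < m → suc (m ∸ 2) < m
    suc[n∸2]<n {suc (suc m)} _ = ℕP.≤-refl
    suc[n∸2]<n {suc zero} (s≤s ())
  ... | no ¬allTree with ¬∀⟶∃¬ N _ (λ i → ¬? (isAB? i) →-dec treeEdge? (cx i) (cy i)) ¬allTree
  ...   | i , bad = NonTreeCode.longCycle (cx i) (cy i) (code-valid i) (λ ab → bad (λ ¬ab → ⊥-elim (¬ab ab))) (λ t → bad (λ _ → t))

module EdgeCodes (G : Graph) (a b c : Fin (n G)) (tri : IsTriangle G a b c)
    (uniq : ∀ x y z → IsTriangle G x y z → (x ≡ a × y ≡ b × z ≡ c)) where
  open UniqueTriangle G a b c tri uniq

  NotBothInT : V → V → Set
  NotBothInT u v = ¬ (inT u × inT v)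

  abIndex : Fin N
  abIndex = proj₁ (code-surj a b codeAB)

  abIndex-code : code abIndex ≡ (a , b)
  abIndex-code = proj₂ (code-surj a b codeAB)

  Lists : Fin N → V → V → Set
  Lists i u v = code i ≡ (u , v) ⊎ code i ≡ (v , u)

  -- (Abstract: the index is used only through edgeCode-lists.)
  abstract
    codeIndex : V → V → Fin N
    codeIndex x y with code? x y
    ... | yes cd = proj₁ (code-surj x y cd)
    ... | no _   = abIndex

    codeIndex-code : ∀ {x y} → Code x y → code (codeIndex x y) ≡ (x , y)
    codeIndex-code {x} {y} cd with code? x y
    ... | yes cd' = proj₂ (code-surj x y cd')
    ... | no ¬cd  = ⊥-elim (¬cd cd)

    edgeCode : V → V → Fin N
    edgeCode u v with <-cmp u v
    ... | tri< _ _ _ = codeIndex u v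
    ... | tri≈ _ _ _ = abIndex
    ... | tri> _ _ _ = codeIndex v u

    edgeCode-lists : ∀ {u v} → Adj G u v → NotBothInT u v → Lists (edgeCode u v) u v
    edgeCode-lists {u} {v} uv notT with <-cmp u v
    ... | tri< u<v _ _ = inj₁ (codeIndex-code (u<v , uv , (λ { (refl , refl) → notT (aT , cT) }) , (λ { (refl , refl) → notT (bT , cT) })))
    ... | tri≈ _ e _   = ⊥-elim (adj≢ uv e)
    ... | tri> _ _ v<u = inj₂ (codeIndex-code (v<u , adjSym uv , (λ { (refl , refl) → notT (cT , aT) }) , (λ { (refl , refl) → notT (cT , bT) })))

  member-lists : ∀ i {u v x} → Lists i u v → NotBothInT u v → Member i x → x ≡ u ⊎ x ≡ v
  member-lists i {u} {v} {x} (inj₁ e) notT x∈ with subst (λ pr → InClique (proj₁ pr) (proj₂ pr) x) e x∈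
  ... | inj₁ x≡u                    = inj₁ x≡u
  ... | inj₂ (inj₁ x≡v)             = inj₂ x≡v
  ... | inj₂ (inj₂ (refl , refl , _)) = ⊥-elim (notT (aT , bT))
  member-lists i {u} {v} {x} (inj₂ e) notT x∈ with subst (λ pr → InClique (proj₁ pr) (proj₂ pr) x) e x∈
  ... | inj₁ x≡v                    = inj₂ x≡v
  ... | inj₂ (inj₁ x≡u)             = inj₁ x≡u
  ... | inj₂ (inj₂ (refl , refl , _)) = ⊥-elim (notT (bT , aT))

  edgeCode-inj : ∀ {u v u' v'} → Adj G u v → NotBothInT u v → Adj G u' v' → NotBothInT u' v' →
    edgeCode u v ≡ edgeCode u' v' → (u ≡ u' × v ≡ v') ⊎ (u ≡ v' × v ≡ u')
  edgeCode-inj uv notT u'v' notT' e with edgeCode-lists uv notT | edgeCode-lists u'v' notT'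
  ... | inj₁ e₁ | inj₁ e₂ = inj₁ (pairs (trans (≡-sym e₁) (trans (cong code e) e₂)))
    where pairs : ∀ {u v u' v' : V} → (u , v) ≡ (u' , v') → u ≡ u' × v ≡ v'
          pairs refl = refl , refl
  ... | inj₁ e₁ | inj₂ e₂ = inj₂ (pairs (trans (≡-sym e₁) (trans (cong code e) e₂)))
    where pairs : ∀ {u v u' v' : V} → (u , v) ≡ (v' , u') → u ≡ v' × v ≡ u'
          pairs refl = refl , refl
  ... | inj₂ e₁ | inj₁ e₂ = inj₂ (pairs (trans (≡-sym e₁) (trans (cong code e) e₂)))
    where pairs : ∀ {u v u' v' : V} → (v , u) ≡ (u' , v') → u ≡ v' × v ≡ u'
          pairs refl = refl , refl
  ... | inj₂ e₁ | inj₂ e₂ = inj₁ (pairs (trans (≡-sym e₁) (trans (cong code e) e₂)))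
    where pairs : ∀ {u v u' v' : V} → (v , u) ≡ (v' , u') → u ≡ u' × v ≡ v'
          pairs refl = refl , refl

  edgeCode≢ab : ∀ {u v} → Adj G u v → NotBothInT u v → edgeCode u v ≢ abIndex
  edgeCode≢ab {u} {v} uv notT e with edgeCode-lists uv notT
  ... | inj₁ e₁ = notT (ab (trans (≡-sym e₁) (trans (cong code e) abIndex-code)))
    where ab : (u , v) ≡ (a , b) → inT u × inT v
          ab refl = aT , bT
  ... | inj₂ e₁ = notT (ba (trans (≡-sym e₁) (trans (cong code e) abIndex-code)))
    where ba : (v , u) ≡ (a , b) → inT u × inT v
          ba refl = bT , aT

-- Take a spanning-tree ordering starting along the cycle, and label each
-- position i ≥ 1 (vertex u, parent p) by a code whose clique lies within
-- positions ≤ i: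
--   * the code of the tree edge up, if u, p are not both in T;
--   * the code ab (the clique T), if all of T is placed by position i;
--   * the code of the closing edge q m q 0 otherwise.
-- These labels are pairwise distinct.  The vertex at position i + 1 is then
-- the common prey of the clique labelled i, and each unused code gets its
-- own new isolated vertex as common prey; arcs increase the position, so D
-- is acyclic.
module RepresentationFromLongCycle (G : Graph) (connected : Connected G) (a b c : Fin (n G))
    (tri : IsTriangle G a b c) (uniq : ∀ x y z → IsTriangle G x y z → (x ≡ a × y ≡ b × z ≡ c))
    (C : Cycles.Cycle G) (normalised : Normalise.Normalised G a b c tri uniq C) where
  open UniqueTriangle G a b c tri uniq
  open EdgeCodes G a b c tri uniq
  open TreeOrderings G connected hiding (V)
  open Normalise G a b c tri uniq using (Normalised)
  open Cycles.Cycle C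

  m<n : m < n G
  m<n = injective⇒≤ {f = λ (j : Fin (suc m)) → q (toℕ j)}
    (λ {i} {j} e → toℕ-injective (inj _ _ (ℕP.≤-pred (toℕ<n i)) (ℕP.≤-pred (toℕ<n j)) e))

  open TreeOrderingAlong (treeOrderingAlong q m m<n inj (λ i lt → adjSym (step i lt)))
  open TreeOrdering ordering

  pos-q : ∀ j → j ≤ m → pos (q j) ≡ j
  pos-q j le = trans (cong pos (≡-sym (along j le))) (pos-ord j (ℕP.≤-<-trans le m<n))

  0<m : 0 < m
  0<m = ℕP.<-≤-trans (s≤s z≤n) m≥3

  noFourInTInOrder : ∀ {x y z w} → inT x → inT y → inT z → inT w →
    pos x < pos y → pos y < pos z → pos z < pos w → ⊥
  noFourInTInOrder tx ty tz tw xy yz zw =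
    noFourInT tx ty tz tw (apart xy) (apart (ℕP.<-trans xy yz)) (apart (ℕP.<-trans xy (ℕP.<-trans yz zw)))
      (apart yz) (apart (ℕP.<-trans yz zw)) (apart zw)
    where
    apart : ∀ {u v} → pos u < pos v → u ≢ v
    apart lt refl = ℕP.<-irrefl refl lt

  -- By normalisation, an edge q (j−1) q j of the cycle inside T can only
  -- occur once all of T has been placed.
  cycleEdgeInT⇒TPlaced : ∀ j {t} → 1 ≤ j → j ≤ m → inT (q (pred j)) → inT (q j) → inT t → j < pos t → ⊥
  cycleEdgeInT⇒TPlaced (suc zero) _ le _ q1∈T _ _ = excluded normalised
    where
    excluded : Normalised C → ⊥
    excluded (inj₁ (_ , q1∉T)) = q1∉T q1∈T
    excluded (inj₂ avoids)     = avoids 1 le q1∈T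
  cycleEdgeInT⇒TPlaced (suc (suc k)) _ le qk+1∈T qk+2∈T t∈T later = excluded normalised
    where
    excluded : Normalised C → ⊥
    excluded (inj₂ avoids)      = avoids (suc (suc k)) le qk+2∈T
    excluded (inj₁ (q0∈T , _)) = noFourInTInOrder q0∈T qk+1∈T qk+2∈T t∈T
      (subst₂ _<_ (≡-sym (pos-q 0 z≤n)) (≡-sym (pos-q (suc k) (ℕP.<⇒≤ le))) (s≤s z≤n))
      (subst₂ _<_ (≡-sym (pos-q (suc k) (ℕP.<⇒≤ le))) (≡-sym (pos-q (suc (suc k)) le)) ℕP.≤-refl)
      (subst (_< pos _) (≡-sym (pos-q (suc (suc k)) le)) later)

  TEdge : ℕ → Set
  TEdge i = inT (ord i) × inT (par (ord i))

  TPlaced : ℕ → Set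
  TPlaced i = pos a ≤ i × pos b ≤ i × pos c ≤ i

  -- (Abstract: the labels below are only used through the view LabelView.)
  abstract
    tEdge? : ∀ i → Dec (TEdge i)
    tEdge? i = inT? (ord i) ×-dec inT? (par (ord i))

    tPlaced? : ∀ i → Dec (TPlaced i)
    tPlaced? i = (pos a ℕP.≤? i) ×-dec ((pos b ℕP.≤? i) ×-dec (pos c ℕP.≤? i))

  TPlaced⇒≤ : ∀ {i x} → TPlaced i → inT x → pos x ≤ i
  TPlaced⇒≤ (p , _ , _) (inj₁ refl)        = p
  TPlaced⇒≤ (_ , p , _) (inj₂ (inj₁ refl)) = p
  TPlaced⇒≤ (_ , _ , p) (inj₂ (inj₂ refl)) = p

  notPlaced⇒later : ∀ i → ¬ TPlaced i → Σ V λ t → inT t × i < pos t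
  notPlaced⇒later i notPlaced with pos a ℕP.≤? i | pos b ℕP.≤? i | pos c ℕP.≤? i
  ... | yes pa | yes pb | yes pc = ⊥-elim (notPlaced (pa , pb , pc))
  ... | no pa  | _      | _      = a , aT , ℕP.≰⇒> pa
  ... | yes _  | no pb  | _      = b , bT , ℕP.≰⇒> pb
  ... | yes _  | yes _  | no pc  = c , cT , ℕP.≰⇒> pc

  closingIndex : Fin N
  closingIndex = edgeCode (q m) (q 0)

  labelFrom : ∀ i → Dec (TEdge i) → Dec (TPlaced i) → Fin N
  labelFrom i (yes _) (yes _) = abIndex
  labelFrom i (yes _) (no _)  = closingIndex
  labelFrom i (no _)  _       = edgeCode (ord i) (par (ord i))

  label : ℕ → Fin N
  label i = labelFrom i (tEdge? i) (tPlaced? i)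

  data LabelView (i : ℕ) : Set where
    treeEdgeLabel : ¬ TEdge i → label i ≡ edgeCode (ord i) (par (ord i)) → LabelView i
    triangleLabel : TEdge i → TPlaced i → label i ≡ abIndex → LabelView i
    closingLabel  : TEdge i → ¬ TPlaced i → label i ≡ closingIndex → LabelView i

  labelView : ∀ i → LabelView i
  labelView i = fromDecisions (tEdge? i) (tPlaced? i) refl
    where
    fromDecisions : ∀ d₁ d₂ → label i ≡ labelFrom i d₁ d₂ → LabelView i
    fromDecisions (yes e) (yes p) eq = triangleLabel e p eq
    fromDecisions (yes e) (no p)  eq = closingLabel e p eq
    fromDecisions (no e)  _       eq = treeEdgeLabel e eq

  module AtPosition (i : ℕ) (1≤i : 1 ≤ i) (i<n : i < n G) where
    u : V
    u = ord i
    p : V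
    p = par u

    pos-u : pos u ≡ i
    pos-u = pos-ord i i<n

    0<pos-u : 0 < pos u
    0<pos-u = subst (0 <_) (≡-sym pos-u) 1≤i

    up : Adj G u p
    up = parAdj u 0<pos-u

    pos-p<i : pos p < i
    pos-p<i = subst (pos p <_) pos-u (par< u 0<pos-u)

    -- A tree edge inside T placed before the whole of T comes after the
    -- cycle path, and then the closing edge q m q 0 is not inside T (else
    -- q 0, q m, u and a later vertex of T would be four vertices of T).
    earlyTEdge : TEdge i → ¬ TPlaced i → m < i × NotBothInT (q m) (q 0)
    earlyTEdge (u∈T , p∈T) notPlaced with notPlaced⇒later i notPlaced
    ... | t , t∈T , i<t = m<i , closingNotInT
      where
      afterPath : ∀ j → j ≡ i → j ≤ m → ⊥
      afterPath zero    e _  = ℕP.<-irrefl e 1≤i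
      afterPath (suc j) e le = cycleEdgeInT⇒TPlaced (suc j) (s≤s z≤n) le
        (subst inT (trans (cong par (trans (cong ord (≡-sym e)) (along (suc j) le))) (alongPar j le)) p∈T)
        (subst inT (trans (cong ord (≡-sym e)) (along (suc j) le)) u∈T)
        t∈T (subst (_< pos t) (≡-sym e) i<t)
      m<i : m < i
      m<i with m ℕP.<? i
      ... | yes lt = lt
      ... | no ¬lt = ⊥-elim (afterPath i refl (ℕP.≮⇒≥ ¬lt))
      closingNotInT : NotBothInT (q m) (q 0)
      closingNotInT (qm∈T , q0∈T) = noFourInTInOrder q0∈T qm∈T u∈T t∈T
        (subst₂ _<_ (≡-sym (pos-q 0 z≤n)) (≡-sym (pos-q m ℕP.≤-refl)) 0<m)
        (subst₂ _<_ (≡-sym (pos-q m ℕP.≤-refl)) (≡-sym pos-u) m<i)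
        (subst (_< pos t) (≡-sym pos-u) i<t)

    label-members : ∀ x → Member (label i) x → pos x ≤ i
    label-members x x∈ with labelView i
    ... | treeEdgeLabel notT eq = endpoint (member-lists _ (edgeCode-lists up notT) notT (subst (λ j → Member j x) eq x∈))
      where
      endpoint : x ≡ u ⊎ x ≡ p → pos x ≤ i
      endpoint (inj₁ refl) = ℕP.≤-reflexive pos-u
      endpoint (inj₂ refl) = ℕP.<⇒≤ pos-p<i
    ... | triangleLabel _ placed eq = inTriangle (subst (λ pr → InClique (proj₁ pr) (proj₂ pr) x) abIndex-code (subst (λ j → Member j x) eq x∈))
      where
      inTriangle : InClique a b x → pos x ≤ i
      inTriangle (inj₁ refl)                = TPlaced⇒≤ placed aT
      inTriangle (inj₂ (inj₁ refl))         = TPlaced⇒≤ placed bT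
      inTriangle (inj₂ (inj₂ (_ , _ , refl))) = TPlaced⇒≤ placed cT
    ... | closingLabel tEdge notPlaced eq = endpoint (member-lists _ (edgeCode-lists close closingNotInT) closingNotInT (subst (λ j → Member j x) eq x∈))
      where
      early : m < i × NotBothInT (q m) (q 0)
      early = earlyTEdge tEdge notPlaced
      closingNotInT = proj₂ early
      endpoint : x ≡ q m ⊎ x ≡ q 0 → pos x ≤ i
      endpoint (inj₁ refl) = ℕP.≤-trans (ℕP.≤-reflexive (pos-q m ℕP.≤-refl)) (ℕP.<⇒≤ (proj₁ early))
      endpoint (inj₂ refl) = ℕP.≤-trans (ℕP.≤-reflexive (pos-q 0 z≤n)) z≤n

  -- A tree edge u p (u at position i ≥ 1) never has the code of the closing
  -- edge q m q 0: it would be that edge, but q 0 is the root and the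
  -- parent of q m is q (m − 1) ≠ q 0.
  treeEdge≢closing : ∀ i u → Adj G u (par u) → NotBothInT u (par u) → pos u ≡ i → 1 ≤ i →
    NotBothInT (q m) (q 0) → edgeCode u (par u) ≢ closingIndex
  treeEdge≢closing i u up notT pos-u 1≤i closingNotT e with edgeCode-inj up notT close closingNotT e
  ... | inj₂ (u≡q0 , _)        = ℕP.<-irrefl (trans (≡-sym (pos-q 0 z≤n)) (trans (cong pos (≡-sym u≡q0)) pos-u)) 1≤i
  ... | inj₁ (u≡qm , par≡q0) = lastStep m refl
    where
    lastStep : ∀ k → k ≡ m → ⊥
    lastStep zero    e = ℕP.<-irrefl e 0<m
    lastStep (suc k) e = ℕP.<-irrefl (≡-sym k≡0) (ℕP.<-≤-trans (s≤s z≤n) (ℕP.≤-pred (subst (3 ≤_) (≡-sym e) m≥3)))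
      where
      k<m : k < m
      k<m = subst (k <_) e ℕP.≤-refl
      k≡0 : k ≡ 0
      k≡0 = inj k 0 (ℕP.<⇒≤ k<m) z≤n
        (trans (≡-sym (alongPar k k<m)) (trans (cong (λ t → par (q t)) e) (trans (cong par (≡-sym u≡qm)) par≡q0)))

  -- Two tree edges inside T at positions i < j, the later one placed before
  -- all of T, would give four vertices of T in increasing positions.
  twoEarlyTEdges : ∀ i j → i < j → ∀ p u w → inT u × inT p → inT w × inT (par w) → ¬ TPlaced j →
    pos p < i → pos u ≡ i → pos w ≡ j → ⊥
  twoEarlyTEdges i j i<j p u w (u∈T , p∈T) (w∈T , _) notPlaced p<i pos-u pos-w
    with notPlaced⇒later j notPlaced
  ... | t , t∈T , j<t = noFourInTInOrder p∈T u∈T w∈T t∈T (subst (pos p <_) (≡-sym pos-u) p<i)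
      (subst₂ _<_ (≡-sym pos-u) (≡-sym pos-w) i<j) (subst (_< pos t) (≡-sym pos-w) j<t)

  label-inj : ∀ i j → 1 ≤ i → i < n G → 1 ≤ j → j < n G → label i ≡ label j → i ≡ j
  label-inj i j 1≤i i<n 1≤j j<n e = compare (labelView i) (labelView j)
    where
    module I = AtPosition i 1≤i i<n
    module J = AtPosition j 1≤j j<n
    compare : LabelView i → LabelView j → i ≡ j
    compare (treeEdgeLabel notT eᵢ) (treeEdgeLabel notT' eⱼ) with edgeCode-inj I.up notT J.up notT' (trans (≡-sym eᵢ) (trans e eⱼ))
    ... | inj₁ (u≡u' , _) = trans (≡-sym I.pos-u) (trans (cong pos u≡u') J.pos-u)
    ... | inj₂ (u≡p' , p≡u') = ⊥-elim (ℕP.<-asym i<j j<i)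
      where
      i<j : i < j
      i<j = subst (_< j) (trans (cong pos (≡-sym u≡p')) I.pos-u) J.pos-p<i
      j<i : j < i
      j<i = subst (_< i) (trans (cong pos p≡u') J.pos-u) I.pos-p<i
    compare (treeEdgeLabel notT eᵢ) (triangleLabel _ _ eⱼ) = ⊥-elim (edgeCode≢ab I.up notT (trans (≡-sym eᵢ) (trans e eⱼ)))
    compare (triangleLabel _ _ eᵢ) (treeEdgeLabel notT eⱼ) = ⊥-elim (edgeCode≢ab J.up notT (trans (≡-sym eⱼ) (trans (≡-sym e) eᵢ)))
    compare (treeEdgeLabel notT eᵢ) (closingLabel tE nP eⱼ) =
      ⊥-elim (treeEdge≢closing i I.u I.up notT I.pos-u 1≤i (proj₂ (J.earlyTEdge tE nP)) (trans (≡-sym eᵢ) (trans e eⱼ)))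
    compare (closingLabel tE nP eᵢ) (treeEdgeLabel notT eⱼ) =
      ⊥-elim (treeEdge≢closing j J.u J.up notT J.pos-u 1≤j (proj₂ (I.earlyTEdge tE nP)) (trans (≡-sym eⱼ) (trans (≡-sym e) eᵢ)))
    compare (triangleLabel _ _ eᵢ) (closingLabel tE nP eⱼ) =
      ⊥-elim (edgeCode≢ab close (proj₂ (J.earlyTEdge tE nP)) (≡-sym (trans (≡-sym eᵢ) (trans e eⱼ))))
    compare (closingLabel tE nP eᵢ) (triangleLabel _ _ eⱼ) =
      ⊥-elim (edgeCode≢ab close (proj₂ (I.earlyTEdge tE nP)) (trans (≡-sym eᵢ) (trans e eⱼ)))
    compare (triangleLabel tEᵢ placedᵢ _) (triangleLabel tEⱼ placedⱼ _) with ℕP.<-cmp i j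
    ... | tri≈ _ i≡j _ = i≡j
    ... | tri< i<j _ _ = ⊥-elim (ℕP.<-irrefl refl (ℕP.<-≤-trans i<j (subst (_≤ i) J.pos-u (TPlaced⇒≤ placedᵢ (proj₁ tEⱼ)))))
    ... | tri> _ _ j<i = ⊥-elim (ℕP.<-irrefl refl (ℕP.<-≤-trans j<i (subst (_≤ j) I.pos-u (TPlaced⇒≤ placedⱼ (proj₁ tEᵢ)))))
    compare (closingLabel tEᵢ nPᵢ _) (closingLabel tEⱼ nPⱼ _) with ℕP.<-cmp i j
    ... | tri≈ _ i≡j _ = i≡j
    ... | tri< i<j _ _ = ⊥-elim (twoEarlyTEdges i j i<j I.p I.u J.u tEᵢ tEⱼ nPⱼ I.pos-p<i I.pos-u J.pos-u)
    ... | tri> _ _ j<i = ⊥-elim (twoEarlyTEdges j i j<i J.p J.u I.u tEⱼ tEᵢ nPᵢ J.pos-p<i J.pos-u I.pos-u)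

  -- The positions 1, …, n − 2; the clique labelled i preys on position i + 1.
  labelled : Fin (n G ∸ 2) → ℕ
  labelled t = suc (toℕ t)

  labelled+1<n : ∀ t → suc (labelled t) < n G
  labelled+1<n t = below (n G) (toℕ<n t)
    where
    below : ∀ n' {s} → s < n' ∸ 2 → suc (suc s) < n'
    below (suc (suc n')) lt = s≤s (s≤s lt)

  labelled<n : ∀ t → labelled t < n G
  labelled<n t = ℕP.<-trans (ℕP.n<1+n _) (labelled+1<n t)

  labelled-inj : ∀ t t' → label (labelled t) ≡ label (labelled t') → t ≡ t'
  labelled-inj t t' e = toℕ-injective (ℕP.suc-injective (label-inj _ _ (s≤s z≤n) (labelled<n t) (s≤s z≤n) (labelled<n t') e))

  Used : Fin N → Set
  Used j = ∃ λ t → label (labelled t) ≡ j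

  -- The codes not used as labels; each will prey on a new vertex of its own.
  abstract
    unused : Enumeration (λ j → ¬ Used j)
    unused = enumerate (λ j → ¬ Used j) (λ j → ¬? (any? (λ t → label (labelled t) ≟ j)))

  k : ℕ
  k = Enumeration.size unused

  leftover : Fin k → Fin N
  leftover = Enumeration.elem unused

  -- The vertices of G ∪ I_k, split into old and new ones, and the arcs of D:
  -- x → y when y is at position ≥ 2 and x in the clique labelled pos y − 1,
  -- x → l when x is in the clique of the l-th unused code.
  Vertex : Set
  Vertex = Fin (n G) ⊎ Fin k

  Preys : Vertex → Vertex → Set
  Preys (inj₁ x) (inj₁ y) = 2 ≤ pos y × Member (label (pos y ∸ 1)) x
  Preys (inj₁ x) (inj₂ l) = Member (leftover l) x
  Preys (inj₂ _) _        = ⊥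

  preys? : ∀ s t → Dec (Preys s t)
  preys? (inj₁ x) (inj₁ y) = (2 ℕP.≤? pos y) ×-dec member? (label (pos y ∸ 1)) x
  preys? (inj₁ x) (inj₂ l) = member? (leftover l) x
  preys? (inj₂ _) _        = no (λ ())

  vertex : Fin (n G + k) → Vertex
  vertex u = splitAt (n G) u

  D : Digraph (n G + k)
  D u w = ⌊ preys? (vertex u) (vertex w) ⌋

  -- Every arc increases the rank (the position, or n for a new vertex).
  rank : Vertex → ℕ
  rank (inj₁ y) = pos y
  rank (inj₂ _) = n G

  preys-rank : ∀ s t → Preys s t → rank s < rank t
  preys-rank (inj₁ x) (inj₁ y) (2≤y , x∈) = ℕP.≤-<-trans
    (AtPosition.label-members (pos y ∸ 1) (ℕP.∸-monoˡ-≤ 1 2≤y) (ℕP.≤-<-trans (ℕP.m∸n≤m (pos y) 1) (pos<n y)) x x∈)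
    (pred< (pos y) 2≤y)
    where
    pred< : ∀ r → 2 ≤ r → r ∸ 1 < r
    pred< (suc r) _ = ℕP.≤-refl
  preys-rank (inj₁ x) (inj₂ l) _ = pos<n x

  acyclic : Acyclic D
  acyclic v p = ℕP.<-irrefl refl (increasing p)
    where
    increasing : ∀ {u w} → TransClosure (Arc D) u w → rank (vertex u) < rank (vertex w)
    increasing [ r ]    = preys-rank _ _ (toWitness r)
    increasing (r ∷ p) = ℕP.<-trans (preys-rank _ _ (toWitness r)) (increasing p)

  preyOf : ∀ j → Σ (Fin (n G + k)) λ v → ∀ x → Member j x → Preys (inj₁ x) (vertex v)
  preyOf j with any? (λ t → label (labelled t) ≟ j)
  ... | yes (t , e) = y ↑ˡ k , λ x x∈ → subst (Preys (inj₁ x)) (≡-sym (splitAt-↑ˡ (n G) y k))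
        (subst (2 ≤_) (≡-sym pos-y) (s≤s (s≤s z≤n)) ,
         subst (λ r → Member (label (r ∸ 1)) x) (≡-sym pos-y) (subst (λ i → Member i x) (≡-sym e) x∈))
    where
    y : V
    y = ord (suc (labelled t))
    pos-y : pos y ≡ suc (labelled t)
    pos-y = pos-ord _ (labelled+1<n t)
  ... | no ¬used = n G ↑ʳ l , λ x x∈ → subst (Preys (inj₁ x)) (≡-sym (splitAt-↑ʳ (n G) k l))
        (subst (λ i → Member i x) (≡-sym (proj₂ found)) x∈)
    where
    found : ∃ λ l → leftover l ≡ j
    found = Enumeration.elem-onto unused j ¬used
    l : Fin k
    l = proj₁ found

  commonPrey⇔adj : ∀ s t → (∀ x → s ≡ inj₁ x → t ≡ inj₁ x → ⊥) →
    T (adjOrNone G s t) ⇔ (∃ λ v → Preys s (vertex v) × Preys t (vertex v))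
  commonPrey⇔adj (inj₁ x) (inj₁ y) distinct = mk⇔ toPrey fromPrey
    where
    toPrey : Adj G x y → ∃ λ v → Preys (inj₁ x) (vertex v) × Preys (inj₁ y) (vertex v)
    toPrey xy with edgeCovered xy
    ... | j , x∈ , y∈ = proj₁ (preyOf j) , proj₂ (preyOf j) x x∈ , proj₂ (preyOf j) y y∈
    x≢y : x ≢ y
    x≢y refl = distinct x refl refl
    fromPrey : (∃ λ v → Preys (inj₁ x) (vertex v) × Preys (inj₁ y) (vertex v)) → Adj G x y
    fromPrey (v , x→v , y→v) = sharedClique (vertex v) x→v y→v
      where
      sharedClique : ∀ s → Preys (inj₁ x) s → Preys (inj₁ y) s → Adj G x y
      sharedClique (inj₁ w) (_ , x∈) (_ , y∈) = memberClique _ x∈ y∈ x≢y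
      sharedClique (inj₂ l) x∈ y∈             = memberClique _ x∈ y∈ x≢y
  commonPrey⇔adj (inj₁ x) (inj₂ l) _ = mk⇔ (λ ()) (λ { (_ , _ , ()) })
  commonPrey⇔adj (inj₂ l) t        _ = mk⇔ (λ ()) (λ { (_ , () , _) })

  represents : IsCompetitionGraphOf (addIsolated G k) D
  represents u w u≢w = mk⇔
    (λ uw → let (v , u→v , w→v) = Equivalence.to equiv (subst T (addIsolated-split G k u w) uw)
            in v , fromWitness u→v , fromWitness w→v)
    (λ { (v , u→v , w→v) → subst T (≡-sym (addIsolated-split G k u w))
            (Equivalence.from equiv (v , toWitness u→v , toWitness w→v)) })
    where
    distinct : ∀ x → vertex u ≡ inj₁ x → vertex w ≡ inj₁ x → ⊥
    distinct x e₁ e₂ = u≢w (trans (≡-sym (join-splitAt (n G) k u))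
      (trans (cong (join (n G) k) (trans e₁ (≡-sym e₂))) (join-splitAt (n G) k w)))
    equiv : T (adjOrNone G (vertex u) (vertex w)) ⇔ (∃ λ v → Preys (vertex u) (vertex v) × Preys (vertex w) (vertex v))
    equiv = commonPrey⇔adj (vertex u) (vertex w) distinct

  count : (n G ∸ 2) + k ≤ N
  count = injective⇒≤ {f = λ z → codeFor (splitAt (n G ∸ 2) z)} (λ {z} {z'} e →
    trans (≡-sym (join-splitAt (n G ∸ 2) k z))
      (trans (cong (join (n G ∸ 2) k) (codeFor-inj (splitAt (n G ∸ 2) z) (splitAt (n G ∸ 2) z') e))
        (join-splitAt (n G ∸ 2) k z')))
    where
    codeFor : Fin (n G ∸ 2) ⊎ Fin k → Fin N
    codeFor (inj₁ t) = label (labelled t)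
    codeFor (inj₂ l) = leftover l
    codeFor-inj : ∀ s s' → codeFor s ≡ codeFor s' → s ≡ s'
    codeFor-inj (inj₁ t) (inj₁ t') e = cong inj₁ (labelled-inj t t' e)
    codeFor-inj (inj₁ t) (inj₂ l)  e = ⊥-elim (Enumeration.elem-sat unused l (t , e))
    codeFor-inj (inj₂ l) (inj₁ t)  e = ⊥-elim (Enumeration.elem-sat unused l (t , ≡-sym e))
    codeFor-inj (inj₂ l) (inj₂ l') e = cong inj₂ (Enumeration.elem-inj unused l l' e)

  representation : Σ ℕ λ k → CompetitionRepresentable G k × (n G ∸ 2) + k ≤ N
  representation = k , (D , acyclic , represents) , count

tightEquation⇔ : ∀ k θ m → (+ k ≡ (+ θ ℤ.- + m) ℤ.+ + 2) ⇔ (k + m ≡ θ + 2)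
tightEquation⇔ k θ m = mk⇔ toℕ-equation fromℕ-equation
  where
  open ≡-Reasoning
  cancel : ∀ (x y : ℤ) → ((x ℤ.- y) ℤ.+ + 2) ℤ.+ y ≡ x ℤ.+ + 2
  cancel = solve-∀
  addSub : ∀ (x y : ℤ) → (x ℤ.+ y) ℤ.- y ≡ x
  addSub = solve-∀
  reorder : ∀ (x y : ℤ) → (x ℤ.+ + 2) ℤ.- y ≡ (x ℤ.- y) ℤ.+ + 2
  reorder = solve-∀
  toℕ-equation : + k ≡ (+ θ ℤ.- + m) ℤ.+ + 2 → k + m ≡ θ + 2
  toℕ-equation e = ℤP.+-injective (begin
    + (k + m)                       ≡⟨ ℤP.pos-+ k m ⟩
    + k ℤ.+ + m                     ≡⟨ cong (ℤ._+ + m) e ⟩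
    ((+ θ ℤ.- + m) ℤ.+ + 2) ℤ.+ + m ≡⟨ cancel (+ θ) (+ m) ⟩
    + θ ℤ.+ + 2                     ≡⟨ ≡-sym (ℤP.pos-+ θ 2) ⟩
    + (θ + 2)                       ∎)
  fromℕ-equation : k + m ≡ θ + 2 → + k ≡ (+ θ ℤ.- + m) ℤ.+ + 2
  fromℕ-equation e = begin
    + k                   ≡⟨ ≡-sym (addSub (+ k) (+ m)) ⟩
    (+ k ℤ.+ + m) ℤ.- + m ≡⟨ cong (ℤ._- + m) (trans (≡-sym (ℤP.pos-+ k m)) (trans (cong +_ e) (ℤP.pos-+ θ 2))) ⟩
    (+ θ ℤ.+ + 2) ℤ.- + m ≡⟨ reorder (+ θ) (+ m) ⟩
    (+ θ ℤ.- + m) ℤ.+ + 2 ∎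

-- For G connected with a unique triangle: θ_E(G) = N, and every k with
-- G ∪ I_k representable satisfies 1 ≤ k and N ≤ (n − 2) + k.  So G is
-- competitively tight iff k(G) = N − (n − 2).
module Tightness (G : Graph) (connected : Connected G) (a b c : Fin (n G))
    (tri : IsTriangle G a b c) (uniq : ∀ x y z → IsTriangle G x y z → (x ≡ a × y ≡ b × z ≡ c)) where
  open UniqueTriangle G a b c tri uniq

  n≡ : n G ≡ suc (suc (n G ∸ 2))
  n≡ = trans (≡-sym (ℕP.m∸n+n≡m {n G} {2} (ℕP.<⇒≤ 2<n))) (ℕP.+-comm (n G ∸ 2) 2)

  codes≤ : ∀ k → CompetitionRepresentable G k → N ≤ (n G ∸ 2) + k
  codes≤ k rep = codeCover-minimal _ (opsutBound G k ((n G ∸ 2) + k) rep (cong (_+ k) n≡))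

  -- G, being connected with at least two vertices, has no isolated vertex.
  noIsolated : ∀ x → ∃ λ y → Adj G x y
  noIsolated x with x ≟ a
  ... | yes refl = b , Aab
  ... | no x≢a   = firstStep (connected x a)
    where
    firstStep : Star (Adj G) x a → ∃ λ y → Adj G x y
    firstStep ε       = ⊥-elim (x≢a refl)
    firstStep (r ◅ _) = _ , r

  representable⇒k≥1 : ∀ k → CompetitionRepresentable G k → 1 ≤ k
  representable⇒k≥1 zero    rep = ⊥-elim (noIsolated⇒¬representable₀ G a noIsolated rep)
  representable⇒k≥1 (suc _) _   = s≤s z≤n

  -- If G is tight, then k(G) + n = N + 2 with k(G) ≥ 1, so n ≤ N + 1.
  tight⇒manyCodes : CompetitivelyTight G → n G ≤ suc N
  tight⇒manyCodes (k , θ , (rep , _) , (θ-cover , θ-minimal) , tight) = ℕP.≤-pred (begin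
    suc (n G)  ≤⟨ ℕP.+-monoˡ-≤ (n G) (representable⇒k≥1 k rep) ⟩
    k + n G    ≡⟨ Equivalence.to (tightEquation⇔ k θ (n G)) tight ⟩
    θ + 2      ≡⟨ cong (_+ 2) θ≡N ⟩
    N + 2      ≡⟨ ℕP.+-comm N 2 ⟩
    suc (suc N) ∎)
    where
    open ℕP.≤-Reasoning
    θ≡N : θ ≡ N
    θ≡N = ℕP.≤-antisym (θ-minimal N codeCover) (codeCover-minimal θ θ-cover)

  attained⇒tight : ∀ k → CompetitionRepresentable G k → (n G ∸ 2) + k ≤ N → CompetitivelyTight G
  attained⇒tight k rep attained =
    k , N , (rep , minimal) , cliqueCoverNumber , Equivalence.from (tightEquation⇔ k N (n G)) equation
    where
    N≡ : N ≡ (n G ∸ 2) + k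
    N≡ = ℕP.≤-antisym (codes≤ k rep) attained
    minimal : ∀ k' → CompetitionRepresentable G k' → k ≤ k'
    minimal k' rep' = ℕP.+-cancelˡ-≤ (n G ∸ 2) k k' (ℕP.≤-trans attained (codes≤ k' rep'))
    equation : k + n G ≡ N + 2
    equation = begin
      k + n G                     ≡⟨ cong (λ t → k + t) n≡ ⟩
      k + suc (suc (n G ∸ 2))     ≡⟨ ℕP.+-comm k _ ⟩
      suc (suc ((n G ∸ 2) + k))   ≡⟨ ℕP.+-comm 2 _ ⟩
      ((n G ∸ 2) + k) + 2         ≡⟨ cong (_+ 2) (≡-sym N≡) ⟩
      N + 2                       ∎
      where open ≡-Reasoning

mainTheorem7 : (G : Graph) → Connected G → ExactlyOneTriangle G →
    (CompetitivelyTight G ⇔ HasCycleOfLengthAtLeast4 G)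
mainTheorem7 G connected (a , b , c , tri , uniq) = mk⇔ tight⇒longCycle longCycle⇒tight
  where
  open Tightness G connected a b c tri uniq

  tight⇒longCycle : CompetitivelyTight G → HasCycleOfLengthAtLeast4 G
  tight⇒longCycle tight = LongCycleFromManyCodes.manyCodes⇒longCycle G connected a b c tri uniq (tight⇒manyCodes tight)

  longCycle⇒tight : HasCycleOfLengthAtLeast4 G → CompetitivelyTight G
  longCycle⇒tight cycle with Normalise.normalise G a b c tri uniq (Cycles.cycleOf G cycle)
  ... | C , normalised with RepresentationFromLongCycle.representation G connected a b c tri uniq C normalised
  ...   | k , rep , attained = attained⇒tight k rep attained
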